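{- Fix $l=2m+1$ with $m>0$ and an integer $r$ prime to $l$. Let $u,v\in\mathbb{Z}/2[x_1,\dots,x_m]$ and let $N$ be the ideal of this ring generated by the elements $R_{i,j}$, $m\ge i>j\ge 1$. Suppose that the ideals $(N,v)$ and $(N,u,v)$ are equal, and that $\phi_r(v)\neq 0$. Then the element $\phi_r(u)/\phi_r(v)$ of the field of fractions of $S$ in fact lies in $S$.
   Context: For an integer $i$, $[i]=\sum x^{n^2}\in\mathbb{Z}/2[[x]]$, summed over $n\in\mathbb{Z}$ with $n\equiv i\pmod l$; $S$ is the subring of $\mathbb{Z}/2[[x]]$ generated over $\mathbb{Z}/2$ by $[1],\dots,[m]$. For $r$ prime to $l$, $\phi_r:\mathbb{Z}/2[x_1,\dots,x_m]\to S$ is the ring homomorphism with $x_k\mapsto[rk]$. For $1\le k\le m$ set $x_{l-k}:=x_k$, and for $m\ge i>j\ge 1$ let $R_{i,j}=x_i^4x_{2j}+x_j^4x_{2i}+x_{2i}x_{2j}+x_{i+j}^2x_{i-j}^2$. -}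

module Defs where

open import Data.Bool using (Bool; true; false; _∧_; _xor_; if_then_else_)
open import Data.Nat as ℕ using (ℕ; zero; suc; _∸_; _≤ᵇ_; _≡ᵇ_)
open import Data.Integer as ℤ using (ℤ; +_; -_)
open import Data.Integer.DivMod using (_%ℕ_)
open import Data.Fin using (Fin; toℕ)
open import Data.List using (List; []; _∷_; _++_; map; foldr; length; filterᵇ; concatMap; upTo; applyUpTo)
open import Data.Vec as Vec using (Vec; tabulate; zipWith; replicate; lookup)
open import Data.Vec.Properties using (≡-dec)
open import Data.Product using (Σ; _×_)
open import Relation.Nullary.Decidable using (⌊_⌋)
open import Relation.Binary.PropositionalEquality using (_≡_)

-- parity of a natural number (Z/2 = Bool with xor as +, ∧ as *)
odd : ℕ → Bool
odd zero = false
odd (suc n) = if odd n then false else true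

PS : Set
PS = ℕ → Bool

_≈ₛ_ : PS → PS → Set
f ≈ₛ g = ∀ k → f k ≡ g k

0ₛ : PS
0ₛ _ = false

1ₛ : PS
1ₛ zero = true
1ₛ (suc _) = false

_+ₛ_ : PS → PS → PS
(f +ₛ g) k = f k xor g k

_*ₛ_ : PS → PS → PS
(f *ₛ g) k = foldr _xor_ false (map (λ i → f i ∧ g (k ∸ i)) (upTo (suc k)))

_^ₛ_ : PS → ℕ → PS
f ^ₛ zero = 1ₛ
f ^ₛ suc n = f *ₛ (f ^ₛ n)

ell : ℕ → ℕ
ell m = suc (2 ℕ.* m)

-- all integers n with -k ≤ n ≤ k (any n with n² = k lies in this range)
intsUpTo : ℕ → List ℤ
intsUpTo k = map (λ a → + a) (upTo (suc k)) ++ map (λ a → - (+ suc a)) (upTo k)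

-- [i] = sum of x^{n²} over n ∈ ℤ with n ≡ i (mod l):
-- coefficient of x^k is the parity of #{n ∈ ℤ : n² = k, n ≡ i mod l}.
bracket : (m : ℕ) → ℤ → PS
bracket m i k =
  odd (length (filterᵇ
    (λ n → (ℤ.∣ n ℤ.* n ∣ ≡ᵇ k) ∧ (((n ℤ.- i) %ℕ ell m) ≡ᵇ 0))
    (intsUpTo k)))

-- Polynomials in Z/2[x_1,…,x_m]
-- A polynomial is a finite list of monomials (exponent vectors; position
-- t : Fin m is the exponent of x_{t+1}); the coefficient of a monomial is
-- the parity of its number of occurrences.

Mono : ℕ → Set
Mono m = Vec ℕ m

Poly : ℕ → Set
Poly m = List (Mono m)

coeff : ∀ {m} → Poly m → Mono m → Bool
coeff p e = odd (length (filterᵇ (λ e' → ⌊ ≡-dec ℕ._≟_ e' e ⌋) p))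

_≈ₚ_ : ∀ {m} → Poly m → Poly m → Set
p ≈ₚ q = ∀ e → coeff p e ≡ coeff q e

0ₚ : ∀ {m} → Poly m
0ₚ = []

_+ₚ_ : ∀ {m} → Poly m → Poly m → Poly m
p +ₚ q = p ++ q

_*ₚ_ : ∀ {m} → Poly m → Poly m → Poly m
p *ₚ q = concatMap (λ a → map (λ b → zipWith ℕ._+_ a b) q) p

_^ₚ_ : ∀ {m} → Poly m → ℕ → Poly m
p ^ₚ zero = replicate _ 0 ∷ []
p ^ₚ suc n = p *ₚ (p ^ₚ n)

varN : (m : ℕ) → ℕ → Poly m
varN m k = tabulate (λ t → if suc (toℕ t) ≡ᵇ k then 1 else 0) ∷ []

-- x_k for 1 ≤ k ≤ 2m, with the convention x_{l-k} := x_k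
X : (m : ℕ) → ℕ → Poly m
X m k = if k ≤ᵇ m then varN m k else varN m (ell m ∸ k)

R : (m : ℕ) → ℕ → ℕ → Poly m
R m i j =
  (((X m i ^ₚ 4) *ₚ X m (2 ℕ.* j)) +ₚ ((X m j ^ₚ 4) *ₚ X m (2 ℕ.* i)))
  +ₚ ((X m (2 ℕ.* i) *ₚ X m (2 ℕ.* j)) +ₚ ((X m (i ℕ.+ j) ^ₚ 2) *ₚ (X m (i ∸ j) ^ₚ 2)))

Rgens : (m : ℕ) → List (Poly m)
Rgens m = concatMap (λ i → applyUpTo (λ j → R m (suc i) (suc j)) i) (upTo m)

sumLin : ∀ {m} → List (Poly m) → List (Poly m) → Poly m
sumLin (c ∷ cs) (g ∷ gs) = (c *ₚ g) +ₚ sumLin cs gs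
sumLin _ _ = 0ₚ

_∈⟨_⟩ : ∀ {m} → Poly m → List (Poly m) → Set
p ∈⟨ gs ⟩ = Σ (List (Poly _)) λ cs → (length cs ≡ length gs) × (p ≈ₚ sumLin cs gs)

_≐_ : ∀ {m} → (Poly m → Set) → (Poly m → Set) → Set
I ≐ J = ∀ p → (I p → J p) × (J p → I p)

-- φ_r : Z/2[x_1,…,x_m] → S,  x_k ↦ [r k]

φMono : (m : ℕ) → ℤ → Mono m → PS
φMono m r e = Vec.foldr (λ _ → PS) _*ₛ_ 1ₛ
  (tabulate (λ t → bracket m (r ℤ.* (+ suc (toℕ t))) ^ₛ lookup e t))

φ : (m : ℕ) → ℤ → Poly m → PS
φ m r p = foldr _+ₛ_ 0ₛ (map (φMono m r) p)

-- S = subring of Z/2[[x]] generated by [1],…,[m] = image of φ_1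
InS : (m : ℕ) → PS → Set
InS m f = Σ (Poly m) λ p → φ m (+ 1) p ≈ₛ f

{-# OPTIONS --safe #-}
-- Since u ∈ (N, v), u = c·v + n with n ∈ N, so φ_r(u) = φ_r(c)·φ_r(v) once φ_r kills N; and
-- φ_r(c) ∈ S because every [rk] equals some [J] with 1 ≤ J ≤ m (r is prime to l and [−J] = [J]).
-- That φ_r(R_{i,j}) = 0 is the identity [A]⁴[2B] + [B]⁴[2A] + [2A][2B] + [A+B]²[A−B]² = 0 for
-- A = ri, B = rj.  By Frobenius and the substitutions a = 2x, resp. a = c + d, b = c − d, every
-- term is the sum of x^{a²+b²} over the pairs a ≡ 2A, b ≡ 2B (mod l) subject to: a even; b even;
-- no condition; a ≡ b (mod 2).  For every pair an odd number of the three parity conditions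
-- holds, so the four sums cancel in Z/2.
module Submission where

open import Data.Bool using (Bool; true; false; not; _∧_; _xor_; if_then_else_; T)
open import Data.Bool.Properties
  using (xor-comm; xor-assoc; xor-identityʳ; xor-same; ∧-comm; ∧-assoc; ∧-zeroʳ; ∧-idem;
         ∧-distribˡ-xor; ∧-commutativeMonoid; xor-∧-commutativeRing; T-≡; ¬-not)
open import Data.Nat as ℕ using (ℕ; zero; suc; _≤_; _<_; z≤n; s≤s; _∸_; _≤ᵇ_; _<ᵇ_; _≡ᵇ_)
  renaming (_+_ to _+ℕ_)
import Data.Nat.Properties as ℕP
open import Data.Integer as ℤ using (ℤ; +_; -[1+_]; ∣_∣; _+_; _*_; -_; _-_; _%ℕ_; _/ℕ_)
import Data.Integer.Properties as ℤP
open import Data.Integer.DivMod using (a≡a%ℕn+[a/ℕn]*n; n%ℕd<d)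
open import Data.Integer.Divisibility.Signed using (_∣_; divides; ∣-refl; ∣m∣n⇒∣m+n; ∣m⇒∣-m; ∣m∣n⇒∣m-n; ∣n⇒∣m*n; ∣⇒∣ᵤ)
open import Data.Integer.Tactic.RingSolver using (solve-∀)
open import Data.List as List using (List; []; _∷_; _++_; map; foldr; length; filterᵇ; concatMap; upTo; applyUpTo)
import Data.List.Properties as ListP
open import Data.List.Relation.Unary.All using (All; []; _∷_)
import Data.List.Relation.Unary.All.Properties as AllP
open import Data.List.Membership.Propositional using (_∈_)
open import Data.List.Membership.Propositional.Properties using (∈-++⁺ˡ; ∈-++⁺ʳ)
open import Data.List.Relation.Unary.Any using (here; there)
open import Function using (_∘_; case_of_)
open import Function.Bundles using (Equivalence)
open import Data.Product using (_×_; _,_; proj₁; proj₂; Σ)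
open import Data.Sum using (_⊎_; inj₁; inj₂)
open import Data.Empty using (⊥-elim)
open import Relation.Binary.PropositionalEquality
open import Relation.Binary.Bundles using (Setoid)
import Relation.Binary.Reasoning.Setoid as SetoidReasoning
open import Relation.Nullary using (¬_; yes; no)
open import Relation.Nullary.Decidable using (⌊_⌋; toWitness; fromWitness)
open import Data.Vec as Vec using (Vec; []; _∷_; tabulate; lookup; zipWith)
open import Data.Vec.Properties using (≡-dec)
open import Data.Fin as Fin using (Fin; toℕ)
import Data.Fin.Properties as FinP
open import Data.Nat.Coprimality using (Coprime; coprime-divisor) renaming (sym to Coprime-sym)
open import Data.Nat.Divisibility using (∣⇒≤) renaming (_∣_ to _ℕ∣_)
open import Level using (0ℓ)

open import Algebra.Bundles using (CommutativeMonoid; CommutativeRing)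
import Algebra.Properties.CommutativeSemigroup as CommSemigroupProperties

open import Defs

module Xor = CommSemigroupProperties (CommutativeRing.+-commutativeSemigroup xor-∧-commutativeRing)
module And = CommSemigroupProperties (CommutativeMonoid.commutativeSemigroup ∧-commutativeMonoid)

-- Sums in Z/2

⨁ : {A : Set} → List A → (A → Bool) → Bool
⨁ []      h = false
⨁ (x ∷ L) h = h x xor ⨁ L h

module _ {A : Set} where

  ⨁-foldr : (L : List A) (h : A → Bool) → foldr _xor_ false (map h L) ≡ ⨁ L h
  ⨁-foldr []      h = refl
  ⨁-foldr (x ∷ L) h = cong (h x xor_) (⨁-foldr L h)

  ⨁-++ : (L M : List A) (h : A → Bool) → ⨁ (L ++ M) h ≡ ⨁ L h xor ⨁ M h
  ⨁-++ []      M h = refl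
  ⨁-++ (x ∷ L) M h = trans (cong (h x xor_) (⨁-++ L M h)) (sym (xor-assoc (h x) _ _))

  ⨁-cong : (L : List A) {h g : A → Bool} → (∀ x → h x ≡ g x) → ⨁ L h ≡ ⨁ L g
  ⨁-cong []      e = refl
  ⨁-cong (x ∷ L) e = cong₂ _xor_ (e x) (⨁-cong L e)

  ⨁-cong-∈ : (L : List A) {h g : A → Bool} → (∀ x → x ∈ L → h x ≡ g x) → ⨁ L h ≡ ⨁ L g
  ⨁-cong-∈ []      e = refl
  ⨁-cong-∈ (x ∷ L) e = cong₂ _xor_ (e x (here refl)) (⨁-cong-∈ L (λ y y∈L → e y (there y∈L)))

  ⨁-false : (L : List A) → ⨁ L (λ _ → false) ≡ false
  ⨁-false []      = refl
  ⨁-false (x ∷ L) = ⨁-false L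

  ⨁-distrib-xor : (L : List A) (h g : A → Bool) → ⨁ L (λ x → h x xor g x) ≡ ⨁ L h xor ⨁ L g
  ⨁-distrib-xor []      h g = refl
  ⨁-distrib-xor (x ∷ L) h g =
    trans (cong ((h x xor g x) xor_) (⨁-distrib-xor L h g)) (Xor.interchange (h x) (g x) _ _)

  ∧-distribˡ-⨁ : (b : Bool) (L : List A) (h : A → Bool) → b ∧ ⨁ L h ≡ ⨁ L (λ x → b ∧ h x)
  ∧-distribˡ-⨁ b []      h = ∧-zeroʳ b
  ∧-distribˡ-⨁ b (x ∷ L) h = trans (∧-distribˡ-xor b (h x) _) (cong ((b ∧ h x) xor_) (∧-distribˡ-⨁ b L h))

  ∧-distribʳ-⨁ : (b : Bool) (L : List A) (h : A → Bool) → ⨁ L h ∧ b ≡ ⨁ L (λ x → h x ∧ b)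
  ∧-distribʳ-⨁ b L h = trans (∧-comm _ b) (trans (∧-distribˡ-⨁ b L h) (⨁-cong L (λ x → ∧-comm b (h x))))

  ⨁-map : {B : Set} (f : B → A) (L : List B) (h : A → Bool) → ⨁ (map f L) h ≡ ⨁ L (h ∘ f)
  ⨁-map f []      h = refl
  ⨁-map f (x ∷ L) h = cong (h (f x) xor_) (⨁-map f L h)

  odd-length-filterᵇ : (p : A → Bool) (L : List A) → odd (length (filterᵇ p L)) ≡ ⨁ L p
  odd-length-filterᵇ p []      = refl
  odd-length-filterᵇ p (x ∷ L) with p x
  ... | true  = trans (if-not (odd (length (filterᵇ p L)))) (cong not (odd-length-filterᵇ p L))
    where
    if-not : ∀ b → (if b then false else true) ≡ not b
    if-not false = refl
    if-not true  = refl
  ... | false = odd-length-filterᵇ p L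

⨁-comm : {A B : Set} (L : List A) (M : List B) (h : A → B → Bool) →
  ⨁ L (λ x → ⨁ M (h x)) ≡ ⨁ M (λ y → ⨁ L (λ x → h x y))
⨁-comm []      M h = sym (⨁-false M)
⨁-comm (x ∷ L) M h =
  trans (cong (⨁ M (h x) xor_) (⨁-comm L M h)) (sym (⨁-distrib-xor M (h x) (λ y → ⨁ L (λ x → h x y))))

⨁-concatMap : {A B : Set} (f : B → List A) (L : List B) (h : A → Bool) →
  ⨁ (concatMap f L) h ≡ ⨁ L (λ y → ⨁ (f y) h)
⨁-concatMap f []      h = refl
⨁-concatMap f (y ∷ L) h = trans (⨁-++ (f y) (concatMap f L) h) (cong (⨁ (f y) h xor_) (⨁-concatMap f L h))

⨁-comm₂ : {A B C D : Set} (L : List A) (M : List B) (N : List C) (P : List D) (h : A → B → C → D → Bool) →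
  ⨁ L (λ a → ⨁ M (λ b → ⨁ N (λ c → ⨁ P (λ d → h a b c d)))) ≡
  ⨁ N (λ c → ⨁ P (λ d → ⨁ L (λ a → ⨁ M (λ b → h a b c d))))
⨁-comm₂ L M N P h = begin
  ⨁ L (λ a → ⨁ M (λ b → ⨁ N (λ c → ⨁ P (λ d → h a b c d))))
    ≡⟨ ⨁-cong L (λ a → ⨁-comm M N _) ⟩
  ⨁ L (λ a → ⨁ N (λ c → ⨁ M (λ b → ⨁ P (λ d → h a b c d))))
    ≡⟨ ⨁-cong L (λ a → ⨁-cong N (λ c → ⨁-comm M P _)) ⟩
  ⨁ L (λ a → ⨁ N (λ c → ⨁ P (λ d → ⨁ M (λ b → h a b c d))))
    ≡⟨ ⨁-comm L N _ ⟩
  ⨁ N (λ c → ⨁ L (λ a → ⨁ P (λ d → ⨁ M (λ b → h a b c d))))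
    ≡⟨ ⨁-cong N (λ c → ⨁-comm L P _) ⟩
  ⨁ N (λ c → ⨁ P (λ d → ⨁ L (λ a → ⨁ M (λ b → h a b c d)))) ∎
  where open ≡-Reasoning

∧-distribˡ-⨁⨁ : {A B : Set} (b : Bool) (L : List A) (M : List B) (h : A → B → Bool) →
  b ∧ ⨁ L (λ x → ⨁ M (h x)) ≡ ⨁ L (λ x → ⨁ M (λ y → b ∧ h x y))
∧-distribˡ-⨁⨁ b L M h = trans (∧-distribˡ-⨁ b L _) (⨁-cong L (λ x → ∧-distribˡ-⨁ b M (h x)))

⨁-∧-⨁ : {A B : Set} (L : List A) (M : List B) (h : A → Bool) (g : B → Bool) →
  ⨁ L h ∧ ⨁ M g ≡ ⨁ L (λ x → ⨁ M (λ y → h x ∧ g y))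
⨁-∧-⨁ L M h g = trans (∧-distribʳ-⨁ (⨁ M g) L h) (⨁-cong L (λ x → ∧-distribˡ-⨁ (h x) M g))

⨁⨁-distrib-xor : {A B : Set} (L : List A) (M : List B) (f g : A → B → Bool) →
  ⨁ L (λ a → ⨁ M (λ b → f a b xor g a b)) ≡ ⨁ L (λ a → ⨁ M (f a)) xor ⨁ L (λ a → ⨁ M (g a))
⨁⨁-distrib-xor L M f g =
  trans (⨁-cong L (λ a → ⨁-distrib-xor M (f a) (g a))) (⨁-distrib-xor L (λ a → ⨁ M (f a)) (λ a → ⨁ M (g a)))

⨁⨁-symmetric : {A : Set} (L : List A) (H : A → A → Bool) → (∀ a b → H a b ≡ H b a) →
  ⨁ L (λ a → ⨁ L (H a)) ≡ ⨁ L (λ a → H a a)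
⨁⨁-symmetric []      H H-sym = refl
⨁⨁-symmetric (x ∷ L) H H-sym = begin
  (H x x xor ⨁ L (H x)) xor ⨁ L (λ a → H a x xor ⨁ L (H a))
    ≡⟨ cong ((H x x xor ⨁ L (H x)) xor_) (⨁-distrib-xor L (λ a → H a x) (λ a → ⨁ L (H a))) ⟩
  (H x x xor ⨁ L (H x)) xor (⨁ L (λ a → H a x) xor ⨁ L (λ a → ⨁ L (H a)))
    ≡⟨ cong₂ (λ u v → (H x x xor ⨁ L (H x)) xor (u xor v)) (⨁-cong L (λ a → H-sym a x)) (⨁⨁-symmetric L H H-sym) ⟩
  (H x x xor ⨁ L (H x)) xor (⨁ L (H x) xor ⨁ L (λ a → H a a))
    ≡⟨ xor-cancel-middle (H x x) (⨁ L (H x)) (⨁ L (λ a → H a a)) ⟩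
  H x x xor ⨁ L (λ a → H a a) ∎
  where
  open ≡-Reasoning
  xor-cancel-middle : ∀ a u b → (a xor u) xor (u xor b) ≡ a xor b
  xor-cancel-middle a u b = begin
    (a xor u) xor (u xor b) ≡⟨ xor-assoc a u (u xor b) ⟩
    a xor (u xor (u xor b)) ≡⟨ cong (a xor_) (xor-assoc u u b) ⟨
    a xor ((u xor u) xor b) ≡⟨ cong (λ z → a xor (z xor b)) (xor-same u) ⟩
    a xor b                 ∎

⨁-applyUpTo : (n : ℕ) (f : ℕ → ℕ) (h : ℕ → Bool) → ⨁ (applyUpTo f n) h ≡ ⨁ (upTo n) (h ∘ f)
⨁-applyUpTo zero    f h = refl
⨁-applyUpTo (suc n) f h =
  cong (h (f 0) xor_) (trans (⨁-applyUpTo n (f ∘ suc) h) (sym (⨁-applyUpTo n suc (h ∘ f))))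

⨁-upTo-suc : (n : ℕ) (h : ℕ → Bool) → ⨁ (upTo (suc n)) h ≡ h 0 xor ⨁ (upTo n) (h ∘ suc)
⨁-upTo-suc n h = cong (h 0 xor_) (⨁-applyUpTo n suc h)

≡true⇒T : ∀ {b} → b ≡ true → T b
≡true⇒T = Equivalence.from T-≡

T⇒≡true : ∀ {b} → T b → b ≡ true
T⇒≡true = Equivalence.to T-≡

⇔⇒≡ : ∀ {a b : Bool} → (a ≡ true → b ≡ true) → (b ≡ true → a ≡ true) → a ≡ b
⇔⇒≡ {false} {false} f g = refl
⇔⇒≡ {false} {true}  f g = g refl
⇔⇒≡ {true}  {false} f g = sym (f refl)
⇔⇒≡ {true}  {true}  f g = refl

∧-congˡ-guarded : ∀ b {x y} → (b ≡ true → x ≡ y) → b ∧ x ≡ b ∧ y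
∧-congˡ-guarded false e = refl
∧-congˡ-guarded true  e = e refl

∧-absorbˡ : ∀ {b} g → (g ≡ true → b ≡ true) → b ∧ g ≡ g
∧-absorbˡ false _ = ∧-zeroʳ _
∧-absorbˡ true  p rewrite p refl = refl

∧-intro : ∀ {a b} → a ≡ true → b ≡ true → a ∧ b ≡ true
∧-intro refl refl = refl

∧-elimˡ : ∀ {a b} → a ∧ b ≡ true → a ≡ true
∧-elimˡ {true} _ = refl

∧-elimʳ : ∀ {a b} → a ∧ b ≡ true → b ≡ true
∧-elimʳ {true} e = e

<⇒<ᵇ≡true : ∀ {i n} → i < n → (i <ᵇ n) ≡ true
<⇒<ᵇ≡true i<n = T⇒≡true (ℕP.<⇒<ᵇ i<n)

≤⇒≤ᵇ≡true : ∀ {a b} → a ≤ b → (a ≤ᵇ b) ≡ true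
≤⇒≤ᵇ≡true a≤b = T⇒≡true (ℕP.≤⇒≤ᵇ a≤b)

module Indicator {A : Set} (_==_ : A → A → Bool)
                 (sound : ∀ {x y} → x == y ≡ true → x ≡ y) (reflexive : ∀ x → x == x ≡ true) where

  ==⇒≡ : ∀ {x y} → x == y ≡ true → x ≡ y
  ==⇒≡ = sound

  ≡⇒== : ∀ {x y} → x ≡ y → x == y ≡ true
  ≡⇒== {x} refl = reflexive x

  ==-resp : ∀ {x y x' y'} → (x ≡ y → x' ≡ y') → (x' ≡ y' → x ≡ y) → x == y ≡ x' == y'
  ==-resp f g = ⇔⇒≡ (≡⇒== ∘ f ∘ ==⇒≡) (≡⇒== ∘ g ∘ ==⇒≡)

  ==-sym : ∀ x y → x == y ≡ y == x
  ==-sym x y = ==-resp sym sym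

  ≢⇒==false : ∀ {x y} → x ≢ y → x == y ≡ false
  ≢⇒==false x≢y = ¬-not (x≢y ∘ ==⇒≡)

  ==-∧-subst : ∀ x t (h : A → Bool) → (x == t) ∧ h x ≡ (x == t) ∧ h t
  ==-∧-subst x t h = ∧-congˡ-guarded (x == t) (cong h ∘ ==⇒≡)

  ⨁-==-∧ : (L : List A) (t : A) (h : A → Bool) → ⨁ L (λ x → (x == t) ∧ h x) ≡ ⨁ L (_== t) ∧ h t
  ⨁-==-∧ L t h = trans (⨁-cong L (λ x → ==-∧-subst x t h)) (sym (∧-distribʳ-⨁ (h t) L (_== t)))

module ℕ= = Indicator _≡ᵇ_ (λ {x} {y} e → ℕP.≡ᵇ⇒≡ x y (≡true⇒T e)) (λ x → T⇒≡true (ℕP.≡⇒≡ᵇ x x refl))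

⨁-upTo-≡ᵇ : (n t : ℕ) → ⨁ (upTo n) (_≡ᵇ t) ≡ (t <ᵇ n)
⨁-upTo-≡ᵇ zero    t       = refl
⨁-upTo-≡ᵇ (suc n) zero    = trans (⨁-upTo-suc n (_≡ᵇ 0)) (cong (true xor_) (⨁-false (upTo n)))
⨁-upTo-≡ᵇ (suc n) (suc t) = trans (⨁-upTo-suc n (_≡ᵇ suc t)) (⨁-upTo-≡ᵇ n t)

⨁-upTo-==-∧ : ∀ n t (h : ℕ → Bool) → (h t ≡ true → t < n) → ⨁ (upTo n) (λ i → (i ≡ᵇ t) ∧ h i) ≡ h t
⨁-upTo-==-∧ n t h support = begin
  ⨁ (upTo n) (λ i → (i ≡ᵇ t) ∧ h i)   ≡⟨ ℕ=.⨁-==-∧ (upTo n) t h ⟩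
  ⨁ (upTo n) (_≡ᵇ t) ∧ h t            ≡⟨ cong (_∧ h t) (⨁-upTo-≡ᵇ n t) ⟩
  (t <ᵇ n) ∧ h t                      ≡⟨ ∧-absorbˡ (h t) (<⇒<ᵇ≡true ∘ support) ⟩
  h t                                 ∎
  where open ≡-Reasoning

⨁-upTo-<ᵇ-∧ : (m n : ℕ) → m ≤ n → (h : ℕ → Bool) → ⨁ (upTo n) (λ i → (i <ᵇ m) ∧ h i) ≡ ⨁ (upTo m) h
⨁-upTo-<ᵇ-∧ zero    n       _         h = ⨁-false (upTo n)
⨁-upTo-<ᵇ-∧ (suc m) (suc n) (s≤s m≤n) h =
  trans (⨁-upTo-suc n (λ i → (i <ᵇ suc m) ∧ h i))
        (trans (cong (h 0 xor_) (⨁-upTo-<ᵇ-∧ m n m≤n (h ∘ suc))) (sym (⨁-upTo-suc m h)))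

-- The ring Z/2[[x]]

≈ₛ-refl : ∀ {f} → f ≈ₛ f
≈ₛ-refl k = refl

≈ₛ-sym : ∀ {f g} → f ≈ₛ g → g ≈ₛ f
≈ₛ-sym e k = sym (e k)

≈ₛ-trans : ∀ {f g h} → f ≈ₛ g → g ≈ₛ h → f ≈ₛ h
≈ₛ-trans e e' k = trans (e k) (e' k)

≡⇒≈ₛ : ∀ {f g} → f ≡ g → f ≈ₛ g
≡⇒≈ₛ refl = ≈ₛ-refl

PS-setoid : Setoid 0ℓ 0ℓ
PS-setoid = record { Carrier = PS ; _≈_ = _≈ₛ_
                   ; isEquivalence = record { refl = ≈ₛ-refl ; sym = ≈ₛ-sym ; trans = ≈ₛ-trans } }

module ≈ₛ-Reasoning = SetoidReasoning PS-setoid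

+ₛ-cong : ∀ {f f' g g'} → f ≈ₛ f' → g ≈ₛ g' → (f +ₛ g) ≈ₛ (f' +ₛ g')
+ₛ-cong ef eg k = cong₂ _xor_ (ef k) (eg k)

+ₛ-identityʳ : ∀ f → (f +ₛ 0ₛ) ≈ₛ f
+ₛ-identityʳ f k = xor-identityʳ (f k)

*ₛ-coeff : ∀ f g k → (f *ₛ g) k ≡ ⨁ (upTo (suc k)) (λ i → f i ∧ g (k ∸ i))
*ₛ-coeff f g k = ⨁-foldr (upTo (suc k)) (λ i → f i ∧ g (k ∸ i))

*ₛ-cong : ∀ {f f' g g'} → f ≈ₛ f' → g ≈ₛ g' → (f *ₛ g) ≈ₛ (f' *ₛ g')
*ₛ-cong {f} {f'} {g} {g'} ef eg k = begin
  (f *ₛ g) k                                           ≡⟨ *ₛ-coeff f g k ⟩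
  ⨁ (upTo (suc k)) (λ i → f i ∧ g (k ∸ i))             ≡⟨ ⨁-cong (upTo (suc k)) (λ i → cong₂ _∧_ (ef i) (eg (k ∸ i))) ⟩
  ⨁ (upTo (suc k)) (λ i → f' i ∧ g' (k ∸ i))           ≡⟨ *ₛ-coeff f' g' k ⟨
  (f' *ₛ g') k                                         ∎
  where open ≡-Reasoning

*ₛ-identityˡ : ∀ f → (1ₛ *ₛ f) ≈ₛ f
*ₛ-identityˡ f k = begin
  (1ₛ *ₛ f) k                                          ≡⟨ *ₛ-coeff 1ₛ f k ⟩
  ⨁ (upTo (suc k)) (λ i → 1ₛ i ∧ f (k ∸ i))            ≡⟨ ⨁-upTo-suc k (λ i → 1ₛ i ∧ f (k ∸ i)) ⟩
  f k xor ⨁ (upTo k) (λ _ → false)                     ≡⟨ cong (f k xor_) (⨁-false (upTo k)) ⟩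
  f k xor false                                        ≡⟨ xor-identityʳ (f k) ⟩
  f k                                                  ∎
  where open ≡-Reasoning

*ₛ-zeroʳ : ∀ f → (f *ₛ 0ₛ) ≈ₛ 0ₛ
*ₛ-zeroʳ f k = trans (*ₛ-coeff f 0ₛ k) (trans (⨁-cong (upTo (suc k)) (λ i → ∧-zeroʳ (f i))) (⨁-false (upTo (suc k))))

+-≡ᵇ-∸ : ∀ i j k → i ≤ k → (i +ℕ j ≡ᵇ k) ≡ (j ≡ᵇ k ∸ i)
+-≡ᵇ-∸ i j k i≤k = ⇔⇒≡
  (λ e → ℕ=.≡⇒== (trans (sym (ℕP.m+n∸m≡n i j)) (cong (_∸ i) (ℕ=.==⇒≡ e))))
  (λ e → ℕ=.≡⇒== (trans (cong (i +ℕ_) (ℕ=.==⇒≡ e)) (ℕP.m+[n∸m]≡n i≤k)))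

+-≡ᵇ-≰ : ∀ i j k → ¬ i ≤ k → (i +ℕ j ≡ᵇ k) ≡ false
+-≡ᵇ-≰ i j k i≰k = ¬-not (λ e → i≰k (subst (i ≤_) (ℕ=.==⇒≡ e) (ℕP.m≤m+n i j)))

*ₛ-coeff-pairs : ∀ f g {k n} → k < n →
  (f *ₛ g) k ≡ ⨁ (upTo n) (λ i → ⨁ (upTo n) (λ j → (i +ℕ j ≡ᵇ k) ∧ (f i ∧ g j)))
*ₛ-coeff-pairs f g {k} {n} k<n = sym (begin
  ⨁ (upTo n) (λ i → ⨁ (upTo n) (λ j → (i +ℕ j ≡ᵇ k) ∧ (f i ∧ g j)))
    ≡⟨ ⨁-cong (upTo n) row ⟩
  ⨁ (upTo n) (λ i → (i <ᵇ suc k) ∧ (f i ∧ g (k ∸ i)))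
    ≡⟨ ⨁-upTo-<ᵇ-∧ (suc k) n k<n _ ⟩
  ⨁ (upTo (suc k)) (λ i → f i ∧ g (k ∸ i))
    ≡⟨ *ₛ-coeff f g k ⟨
  (f *ₛ g) k ∎)
  where
  open ≡-Reasoning
  row : ∀ i → ⨁ (upTo n) (λ j → (i +ℕ j ≡ᵇ k) ∧ (f i ∧ g j)) ≡ (i <ᵇ suc k) ∧ (f i ∧ g (k ∸ i))
  row i with i ℕP.≤? k
  ... | yes i≤k = begin
    ⨁ (upTo n) (λ j → (i +ℕ j ≡ᵇ k) ∧ (f i ∧ g j))
      ≡⟨ ⨁-cong (upTo n) (λ j → cong (_∧ (f i ∧ g j)) (+-≡ᵇ-∸ i j k i≤k)) ⟩
    ⨁ (upTo n) (λ j → (j ≡ᵇ k ∸ i) ∧ (f i ∧ g j))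
      ≡⟨ ⨁-upTo-==-∧ n (k ∸ i) (λ j → f i ∧ g j) (λ _ → ℕP.≤-<-trans (ℕP.m∸n≤m k i) k<n) ⟩
    f i ∧ g (k ∸ i)
      ≡⟨ cong (_∧ (f i ∧ g (k ∸ i))) (<⇒<ᵇ≡true (s≤s i≤k)) ⟨
    (i <ᵇ suc k) ∧ (f i ∧ g (k ∸ i)) ∎
  ... | no i≰k = begin
    ⨁ (upTo n) (λ j → (i +ℕ j ≡ᵇ k) ∧ (f i ∧ g j))
      ≡⟨ ⨁-cong (upTo n) (λ j → cong (_∧ (f i ∧ g j)) (+-≡ᵇ-≰ i j k i≰k)) ⟩
    ⨁ (upTo n) (λ _ → false)
      ≡⟨ ⨁-false (upTo n) ⟩
    false
      ≡⟨ cong (_∧ (f i ∧ g (k ∸ i))) (¬-not (λ e → i≰k (ℕP.≤-pred (ℕP.<ᵇ⇒< i (suc k) (≡true⇒T e))))) ⟨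
    (i <ᵇ suc k) ∧ (f i ∧ g (k ∸ i)) ∎

*ₛ-comm : ∀ f g → (f *ₛ g) ≈ₛ (g *ₛ f)
*ₛ-comm f g k = begin
  (f *ₛ g) k
    ≡⟨ *ₛ-coeff-pairs f g ℕP.≤-refl ⟩
  ⨁ I (λ i → ⨁ I (λ j → (i +ℕ j ≡ᵇ k) ∧ (f i ∧ g j)))
    ≡⟨ ⨁-comm I I (λ i j → (i +ℕ j ≡ᵇ k) ∧ (f i ∧ g j)) ⟩
  ⨁ I (λ j → ⨁ I (λ i → (i +ℕ j ≡ᵇ k) ∧ (f i ∧ g j)))
    ≡⟨ ⨁-cong I (λ j → ⨁-cong I (λ i → cong₂ (λ s b → (s ≡ᵇ k) ∧ b) (ℕP.+-comm i j) (∧-comm (f i) (g j)))) ⟩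
  ⨁ I (λ j → ⨁ I (λ i → (j +ℕ i ≡ᵇ k) ∧ (g j ∧ f i)))
    ≡⟨ *ₛ-coeff-pairs g f ℕP.≤-refl ⟨
  (g *ₛ f) k ∎
  where open ≡-Reasoning
        I = upTo (suc k)

*ₛ-identityʳ : ∀ f → (f *ₛ 1ₛ) ≈ₛ f
*ₛ-identityʳ f = ≈ₛ-trans (*ₛ-comm f 1ₛ) (*ₛ-identityˡ f)

convolution₃ : PS → PS → PS → PS
convolution₃ f g h k = ⨁ I (λ i → ⨁ I (λ j → ⨁ I (λ c → (i +ℕ j +ℕ c ≡ᵇ k) ∧ ((f i ∧ g j) ∧ h c))))
  where I = upTo (suc k)

*ₛ-*ₛ≈convolution₃ : ∀ f g h → ((f *ₛ g) *ₛ h) ≈ₛ convolution₃ f g h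
*ₛ-*ₛ≈convolution₃ f g h k = begin
  ((f *ₛ g) *ₛ h) k
    ≡⟨ *ₛ-coeff-pairs (f *ₛ g) h ℕP.≤-refl ⟩
  ⨁ I (λ a → ⨁ I (λ c → (a +ℕ c ≡ᵇ k) ∧ ((f *ₛ g) a ∧ h c)))
    ≡⟨ ⨁-cong I (λ a → ⨁-cong I (λ c → ∧-congˡ-guarded (a +ℕ c ≡ᵇ k)
         (λ e → cong (_∧ h c) (*ₛ-coeff-pairs f g (s≤s (subst (a ≤_) (ℕ=.==⇒≡ e) (ℕP.m≤m+n a c))))))) ⟩
  ⨁ I (λ a → ⨁ I (λ c → (a +ℕ c ≡ᵇ k) ∧ (⨁ I (λ i → ⨁ I (λ j → (i +ℕ j ≡ᵇ a) ∧ (f i ∧ g j))) ∧ h c)))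
    ≡⟨ ⨁-cong I (λ a → ⨁-cong I (λ c → expand a c)) ⟩
  ⨁ I (λ a → ⨁ I (λ c → ⨁ I (λ i → ⨁ I (λ j → Q a c i j))))
    ≡⟨ ⨁-comm₂ I I I I Q ⟩
  ⨁ I (λ i → ⨁ I (λ j → ⨁ I (λ a → ⨁ I (λ c → Q a c i j))))
    ≡⟨ ⨁-cong I (λ i → ⨁-cong I (λ j → ⨁-comm I I (λ a c → Q a c i j))) ⟩
  ⨁ I (λ i → ⨁ I (λ j → ⨁ I (λ c → ⨁ I (λ a → Q a c i j))))
    ≡⟨ ⨁-cong I (λ i → ⨁-cong I (λ j → ⨁-cong I (λ c → collapse i j c))) ⟩
  convolution₃ f g h k ∎
  where
  open ≡-Reasoning
  I = upTo (suc k)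
  Q : ℕ → ℕ → ℕ → ℕ → Bool
  Q a c i j = (i +ℕ j ≡ᵇ a) ∧ ((a +ℕ c ≡ᵇ k) ∧ ((f i ∧ g j) ∧ h c))
  expand : ∀ a c → (a +ℕ c ≡ᵇ k) ∧ (⨁ I (λ i → ⨁ I (λ j → (i +ℕ j ≡ᵇ a) ∧ (f i ∧ g j))) ∧ h c)
                 ≡ ⨁ I (λ i → ⨁ I (λ j → Q a c i j))
  expand a c = begin
    (a +ℕ c ≡ᵇ k) ∧ (⨁ I (λ i → ⨁ I (λ j → (i +ℕ j ≡ᵇ a) ∧ (f i ∧ g j))) ∧ h c)
      ≡⟨ cong ((a +ℕ c ≡ᵇ k) ∧_) (trans (∧-distribʳ-⨁ (h c) I (λ i → ⨁ I (λ j → (i +ℕ j ≡ᵇ a) ∧ (f i ∧ g j))))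
                                        (⨁-cong I (λ i → ∧-distribʳ-⨁ (h c) I (λ j → (i +ℕ j ≡ᵇ a) ∧ (f i ∧ g j))))) ⟩
    (a +ℕ c ≡ᵇ k) ∧ ⨁ I (λ i → ⨁ I (λ j → ((i +ℕ j ≡ᵇ a) ∧ (f i ∧ g j)) ∧ h c))
      ≡⟨ ∧-distribˡ-⨁⨁ (a +ℕ c ≡ᵇ k) I I (λ i j → ((i +ℕ j ≡ᵇ a) ∧ (f i ∧ g j)) ∧ h c) ⟩
    ⨁ I (λ i → ⨁ I (λ j → (a +ℕ c ≡ᵇ k) ∧ (((i +ℕ j ≡ᵇ a) ∧ (f i ∧ g j)) ∧ h c)))
      ≡⟨ ⨁-cong I (λ i → ⨁-cong I (λ j → trans (cong ((a +ℕ c ≡ᵇ k) ∧_) (∧-assoc (i +ℕ j ≡ᵇ a) _ _))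
                                            (And.x∙yz≈y∙xz (a +ℕ c ≡ᵇ k) (i +ℕ j ≡ᵇ a) _))) ⟩
    ⨁ I (λ i → ⨁ I (λ j → Q a c i j)) ∎
  collapse : ∀ i j c → ⨁ I (λ a → Q a c i j) ≡ (i +ℕ j +ℕ c ≡ᵇ k) ∧ ((f i ∧ g j) ∧ h c)
  collapse i j c = begin
    ⨁ I (λ a → Q a c i j)
      ≡⟨ ⨁-cong I (λ a → cong (_∧ ((a +ℕ c ≡ᵇ k) ∧ ((f i ∧ g j) ∧ h c))) (ℕ=.==-sym (i +ℕ j) a)) ⟩
    ⨁ I (λ a → (a ≡ᵇ i +ℕ j) ∧ ((a +ℕ c ≡ᵇ k) ∧ ((f i ∧ g j) ∧ h c)))
      ≡⟨ ⨁-upTo-==-∧ (suc k) (i +ℕ j) (λ a → (a +ℕ c ≡ᵇ k) ∧ ((f i ∧ g j) ∧ h c))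
           (λ e → s≤s (subst (i +ℕ j ≤_) (ℕ=.==⇒≡ (∧-elimˡ e)) (ℕP.m≤m+n (i +ℕ j) c))) ⟩
    (i +ℕ j +ℕ c ≡ᵇ k) ∧ ((f i ∧ g j) ∧ h c) ∎

convolution₃-rotate : ∀ f g h → convolution₃ f g h ≈ₛ convolution₃ g h f
convolution₃-rotate f g h k = begin
  ⨁ I (λ i → ⨁ I (λ j → ⨁ I (λ c → P i j c)))
    ≡⟨ ⨁-comm I I (λ i j → ⨁ I (λ c → P i j c)) ⟩
  ⨁ I (λ j → ⨁ I (λ i → ⨁ I (λ c → P i j c)))
    ≡⟨ ⨁-cong I (λ j → ⨁-comm I I (λ i c → P i j c)) ⟩
  ⨁ I (λ j → ⨁ I (λ c → ⨁ I (λ i → P i j c)))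
    ≡⟨ ⨁-cong I (λ j → ⨁-cong I (λ c → ⨁-cong I (λ i →
         cong₂ (λ s b → (s ≡ᵇ k) ∧ b) (rotate i j c) (And.xy∙z≈yz∙x (f i) (g j) (h c))))) ⟩
  ⨁ I (λ j → ⨁ I (λ c → ⨁ I (λ i → (j +ℕ c +ℕ i ≡ᵇ k) ∧ ((g j ∧ h c) ∧ f i)))) ∎
  where
  open ≡-Reasoning
  I = upTo (suc k)
  P : ℕ → ℕ → ℕ → Bool
  P i j c = (i +ℕ j +ℕ c ≡ᵇ k) ∧ ((f i ∧ g j) ∧ h c)
  rotate : ∀ i j c → i +ℕ j +ℕ c ≡ j +ℕ c +ℕ i
  rotate i j c = trans (ℕP.+-assoc i j c) (ℕP.+-comm i (j +ℕ c))

*ₛ-assoc : ∀ f g h → ((f *ₛ g) *ₛ h) ≈ₛ (f *ₛ (g *ₛ h))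
*ₛ-assoc f g h = begin
  (f *ₛ g) *ₛ h   ≈⟨ *ₛ-*ₛ≈convolution₃ f g h ⟩
  convolution₃ f g h    ≈⟨ convolution₃-rotate f g h ⟩
  convolution₃ g h f    ≈⟨ *ₛ-*ₛ≈convolution₃ g h f ⟨
  (g *ₛ h) *ₛ f   ≈⟨ *ₛ-comm (g *ₛ h) f ⟩
  f *ₛ (g *ₛ h)   ∎
  where open ≈ₛ-Reasoning

*ₛ-commutativeMonoid : CommutativeMonoid 0ℓ 0ℓ
*ₛ-commutativeMonoid = record
  { Carrier = PS ; _≈_ = _≈ₛ_ ; _∙_ = _*ₛ_ ; ε = 1ₛ
  ; isCommutativeMonoid = record
    { isMonoid = record
      { isSemigroup = record
        { isMagma = record { isEquivalence = Setoid.isEquivalence PS-setoid ; ∙-cong = *ₛ-cong }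
        ; assoc = *ₛ-assoc }
      ; identity = *ₛ-identityˡ , *ₛ-identityʳ }
    ; comm = *ₛ-comm } }

module *ₛ = CommSemigroupProperties (CommutativeMonoid.commutativeSemigroup *ₛ-commutativeMonoid)

^ₛ-cong : ∀ {f g} n → f ≈ₛ g → (f ^ₛ n) ≈ₛ (g ^ₛ n)
^ₛ-cong zero    e = ≈ₛ-refl
^ₛ-cong {f} {g} (suc n) e = *ₛ-cong {f} {g} e (^ₛ-cong n e)

^ₛ-distribˡ-+-*ₛ : ∀ f a b → (f ^ₛ (a +ℕ b)) ≈ₛ ((f ^ₛ a) *ₛ (f ^ₛ b))
^ₛ-distribˡ-+-*ₛ f zero    b = ≈ₛ-sym (*ₛ-identityˡ (f ^ₛ b))
^ₛ-distribˡ-+-*ₛ f (suc a) b = begin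
  f *ₛ (f ^ₛ (a +ℕ b))          ≈⟨ *ₛ-cong {f} {f} ≈ₛ-refl (^ₛ-distribˡ-+-*ₛ f a b) ⟩
  f *ₛ ((f ^ₛ a) *ₛ (f ^ₛ b))   ≈⟨ *ₛ-assoc f (f ^ₛ a) (f ^ₛ b) ⟨
  (f *ₛ (f ^ₛ a)) *ₛ (f ^ₛ b)   ∎
  where open ≈ₛ-Reasoning

-- The evaluation maps φ

φ-coeff : ∀ m r (p : Poly m) k → φ m r p k ≡ ⨁ p (λ e → φMono m r e k)
φ-coeff m r []      k = refl
φ-coeff m r (e ∷ p) k = cong (φMono m r e k xor_) (φ-coeff m r p k)

φ-+ : ∀ m r (p q : Poly m) → φ m r (p +ₚ q) ≈ₛ (φ m r p +ₛ φ m r q)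
φ-+ m r p q k = trans (φ-coeff m r (p ++ q) k)
  (trans (⨁-++ p q _) (sym (cong₂ _xor_ (φ-coeff m r p k) (φ-coeff m r q k))))

module _ {m : ℕ} where

  infix 5 _==ₘ_
  _==ₘ_ : Mono m → Mono m → Bool
  x ==ₘ y = ⌊ ≡-dec ℕP._≟_ x y ⌋

  ==ₘ⇒≡ : ∀ {x y} → x ==ₘ y ≡ true → x ≡ y
  ==ₘ⇒≡ = toWitness ∘ ≡true⇒T

  ==ₘ-refl : ∀ x → x ==ₘ x ≡ true
  ==ₘ-refl x = T⇒≡true (fromWitness {a? = ≡-dec ℕP._≟_ x x} refl)

  module Mono= = Indicator _==ₘ_ ==ₘ⇒≡ ==ₘ-refl

  coeff-⨁ : ∀ (p : Poly m) e → coeff p e ≡ ⨁ p (_==ₘ e)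
  coeff-⨁ p e = odd-length-filterᵇ (_==ₘ e) p

  ⨁-filterᵇ : ∀ (p : Mono m → Bool) L h → ⨁ (filterᵇ p L) h ≡ ⨁ L (λ x → p x ∧ h x)
  ⨁-filterᵇ p []      h = refl
  ⨁-filterᵇ p (x ∷ L) h with p x
  ... | true  = cong (h x xor_) (⨁-filterᵇ p L h)
  ... | false = ⨁-filterᵇ p L h

  dedup : List (Mono m) → List (Mono m)
  dedup []      = []
  dedup (x ∷ L) = x ∷ filterᵇ (λ y → not (y ==ₘ x)) (dedup L)

  dedup-odd : ∀ L y → y ∈ L → ⨁ (dedup L) (y ==ₘ_) ≡ true
  dedup-odd (x ∷ L) y y∈ = begin
    (y ==ₘ x) xor ⨁ (filterᵇ (λ e → not (e ==ₘ x)) (dedup L)) (y ==ₘ_)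
      ≡⟨ cong ((y ==ₘ x) xor_) (⨁-filterᵇ _ (dedup L) (y ==ₘ_)) ⟩
    (y ==ₘ x) xor ⨁ (dedup L) (λ e → not (e ==ₘ x) ∧ (y ==ₘ e))
      ≡⟨ cong ((y ==ₘ x) xor_) (⨁-cong (dedup L) (λ e → trans (∧-comm (not (e ==ₘ x)) (y ==ₘ e))
           (∧-congˡ-guarded (y ==ₘ e) (λ h → cong (λ z → not (z ==ₘ x)) (sym (==ₘ⇒≡ h)))))) ⟩
    (y ==ₘ x) xor ⨁ (dedup L) (λ e → (y ==ₘ e) ∧ not (y ==ₘ x))
      ≡⟨ cong ((y ==ₘ x) xor_) (sym (∧-distribʳ-⨁ (not (y ==ₘ x)) (dedup L) (y ==ₘ_))) ⟩
    (y ==ₘ x) xor (⨁ (dedup L) (y ==ₘ_) ∧ not (y ==ₘ x))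
      ≡⟨ head-or-tail y∈ ⟩
    true ∎
    where
    open ≡-Reasoning
    head-or-tail : y ∈ x ∷ L → ((y ==ₘ x) xor (⨁ (dedup L) (y ==ₘ_) ∧ not (y ==ₘ x))) ≡ true
    head-or-tail y∈ with y ==ₘ x in eq
    ... | true = cong not (∧-zeroʳ (⨁ (dedup L) (y ==ₘ_)))
    head-or-tail (here refl)   | false = case trans (sym (==ₘ-refl y)) eq of λ ()
    head-or-tail (there y∈L) | false = cong (_∧ true) (dedup-odd L y y∈L)

  ⨁-weighted : ∀ (L D : List (Mono m)) → (∀ x → x ∈ L → ⨁ D (x ==ₘ_) ≡ true) → (g : Mono m → Bool) →
    ⨁ L g ≡ ⨁ D (λ e → ⨁ L (_==ₘ e) ∧ g e)
  ⨁-weighted L D odd-in-D g = sym (begin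
    ⨁ D (λ e → ⨁ L (_==ₘ e) ∧ g e)           ≡⟨ ⨁-cong D (λ e → ∧-distribʳ-⨁ (g e) L (_==ₘ e)) ⟩
    ⨁ D (λ e → ⨁ L (λ x → (x ==ₘ e) ∧ g e))  ≡⟨ ⨁-cong D (λ e → ⨁-cong L (λ x → sym (Mono=.==-∧-subst x e g))) ⟩
    ⨁ D (λ e → ⨁ L (λ x → (x ==ₘ e) ∧ g x))  ≡⟨ ⨁-comm D L (λ e x → (x ==ₘ e) ∧ g x) ⟩
    ⨁ L (λ x → ⨁ D (λ e → (x ==ₘ e) ∧ g x))  ≡⟨ ⨁-cong L (λ x → sym (∧-distribʳ-⨁ (g x) D (x ==ₘ_))) ⟩
    ⨁ L (λ x → ⨁ D (x ==ₘ_) ∧ g x)           ≡⟨ ⨁-cong-∈ L (λ x x∈L → cong (_∧ g x) (odd-in-D x x∈L)) ⟩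
    ⨁ L g                                    ∎)
    where open ≡-Reasoning

  ⨁-resp-≈ₚ : ∀ {p q : Poly m} → p ≈ₚ q → (g : Mono m → Bool) → ⨁ p g ≡ ⨁ q g
  ⨁-resp-≈ₚ {p} {q} p≈q g = begin
    ⨁ p g                             ≡⟨ ⨁-weighted p D (λ x x∈ → dedup-odd (p ++ q) x (∈-++⁺ˡ x∈)) g ⟩
    ⨁ D (λ e → ⨁ p (_==ₘ e) ∧ g e)    ≡⟨ ⨁-cong D (λ e → cong (_∧ g e) (same-count e)) ⟩
    ⨁ D (λ e → ⨁ q (_==ₘ e) ∧ g e)    ≡⟨ ⨁-weighted q D (λ x x∈ → dedup-odd (p ++ q) x (∈-++⁺ʳ p x∈)) g ⟨
    ⨁ q g                             ∎
    where open ≡-Reasoning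
          D = dedup (p ++ q)
          same-count : ∀ e → ⨁ p (_==ₘ e) ≡ ⨁ q (_==ₘ e)
          same-count e = trans (sym (coeff-⨁ p e)) (trans (p≈q e) (coeff-⨁ q e))

φ-cong : ∀ m r (p q : Poly m) → p ≈ₚ q → φ m r p ≈ₛ φ m r q
φ-cong m r p q p≈q k = trans (φ-coeff m r p k) (trans (⨁-resp-≈ₚ {p = p} {q} p≈q (λ e → φMono m r e k)) (sym (φ-coeff m r q k)))

∏ₛ : ∀ {n} → (Fin n → PS) → PS
∏ₛ F = Vec.foldr (λ _ → PS) _*ₛ_ 1ₛ (tabulate F)

∏ₛ-cong : ∀ {n} {F G : Fin n → PS} → (∀ t → F t ≈ₛ G t) → ∏ₛ F ≈ₛ ∏ₛ G
∏ₛ-cong {zero}          F≈G = ≈ₛ-refl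
∏ₛ-cong {suc n} {F} {G} F≈G =
  *ₛ-cong {F Fin.zero} {G Fin.zero} (F≈G Fin.zero) (∏ₛ-cong {F = F ∘ Fin.suc} {G ∘ Fin.suc} (F≈G ∘ Fin.suc))

monomial : ∀ {n} → (Fin n → PS) → Vec ℕ n → PS
monomial B e = ∏ₛ (λ t → B t ^ₛ lookup e t)

monomial-+ : ∀ {n} (B : Fin n → PS) (a b : Vec ℕ n) → monomial B (zipWith _+ℕ_ a b) ≈ₛ (monomial B a *ₛ monomial B b)
monomial-+ {zero}  B []       []       = ≈ₛ-sym (*ₛ-identityˡ 1ₛ)
monomial-+ {suc n} B (a ∷ as) (b ∷ bs) = begin
  (B₀ ^ₛ (a +ℕ b)) *ₛ monomial B′ (zipWith _+ℕ_ as bs)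
    ≈⟨ *ₛ-cong {B₀ ^ₛ (a +ℕ b)} {(B₀ ^ₛ a) *ₛ (B₀ ^ₛ b)} (^ₛ-distribˡ-+-*ₛ B₀ a b) (monomial-+ B′ as bs) ⟩
  ((B₀ ^ₛ a) *ₛ (B₀ ^ₛ b)) *ₛ (monomial B′ as *ₛ monomial B′ bs)
    ≈⟨ *ₛ.interchange (B₀ ^ₛ a) (B₀ ^ₛ b) (monomial B′ as) (monomial B′ bs) ⟩
  ((B₀ ^ₛ a) *ₛ monomial B′ as) *ₛ ((B₀ ^ₛ b) *ₛ monomial B′ bs) ∎
  where open ≈ₛ-Reasoning
        B₀ = B Fin.zero
        B′ = B ∘ Fin.suc

monomial-zeros : ∀ {n} (B : Fin n → PS) → monomial B (Vec.replicate n 0) ≈ₛ 1ₛ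
monomial-zeros {zero}  B = ≈ₛ-refl
monomial-zeros {suc n} B = ≈ₛ-trans (*ₛ-cong {1ₛ} {1ₛ} ≈ₛ-refl (monomial-zeros (B ∘ Fin.suc))) (*ₛ-identityˡ 1ₛ)

-- variables indexed from 1, as x_1, …, x_n
monomial-single : ∀ n (F : ℕ → PS) (E : ℕ → ℕ) j → j < n → E (suc j) ≡ 1 → (∀ i → i ≢ j → E (suc i) ≡ 0) →
  monomial {n} (λ t → F (suc (toℕ t))) (tabulate (λ t → E (suc (toℕ t)))) ≈ₛ F (suc j)
monomial-single (suc n) F E zero    _         E₁≡1 E≡0 = begin
  (F 1 ^ₛ E 1) *ₛ monomial {n} (λ t → F (suc (suc (toℕ t)))) (tabulate (λ t → E (suc (suc (toℕ t)))))
    ≈⟨ *ₛ-cong {F 1 ^ₛ E 1} {F 1 ^ₛ 1} (≡⇒≈ₛ (cong (F 1 ^ₛ_) E₁≡1))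
         (monomial-all-zero n (F ∘ suc) (E ∘ suc) (λ i → E≡0 (suc i) (λ ()))) ⟩
  (F 1 *ₛ 1ₛ) *ₛ 1ₛ  ≈⟨ *ₛ-identityʳ (F 1 *ₛ 1ₛ) ⟩
  F 1 *ₛ 1ₛ          ≈⟨ *ₛ-identityʳ (F 1) ⟩
  F 1                ∎
  where
  open ≈ₛ-Reasoning
  monomial-all-zero : ∀ n (F : ℕ → PS) (E : ℕ → ℕ) → (∀ i → E (suc i) ≡ 0) →
    monomial {n} (λ t → F (suc (toℕ t))) (tabulate (λ t → E (suc (toℕ t)))) ≈ₛ 1ₛ
  monomial-all-zero zero    F E E≡0 = ≈ₛ-refl
  monomial-all-zero (suc n) F E E≡0 =
    ≈ₛ-trans (*ₛ-cong {F 1 ^ₛ E 1} {1ₛ} (≡⇒≈ₛ (cong (F 1 ^ₛ_) (E≡0 0))) (monomial-all-zero n (F ∘ suc) (E ∘ suc) (E≡0 ∘ suc)))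
             (*ₛ-identityˡ 1ₛ)
monomial-single (suc n) F E (suc j) (s≤s j<n) E≡1 E≡0 = begin
  (F 1 ^ₛ E 1) *ₛ monomial {n} (λ t → F (suc (suc (toℕ t)))) (tabulate (λ t → E (suc (suc (toℕ t)))))
    ≈⟨ *ₛ-cong {F 1 ^ₛ E 1} {1ₛ} (≡⇒≈ₛ (cong (F 1 ^ₛ_) (E≡0 0 (λ ()))))
         (monomial-single n (F ∘ suc) (E ∘ suc) j j<n E≡1 (λ i i≢j → E≡0 (suc i) (i≢j ∘ ℕP.suc-injective))) ⟩
  1ₛ *ₛ F (suc (suc j))  ≈⟨ *ₛ-identityˡ (F (suc (suc j))) ⟩
  F (suc (suc j))        ∎
  where open ≈ₛ-Reasoning

brackets : ∀ m → ℤ → Fin m → PS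
brackets m r t = bracket m (r * + suc (toℕ t))

φ-* : ∀ m r (p q : Poly m) → φ m r (p *ₚ q) ≈ₛ (φ m r p *ₛ φ m r q)
φ-* m r p q k = begin
  φ m r (p *ₚ q) k
    ≡⟨ φ-coeff m r (p *ₚ q) k ⟩
  ⨁ (p *ₚ q) (λ e → M e k)
    ≡⟨ ⨁-concatMap (λ a → map (zipWith _+ℕ_ a) q) p (λ e → M e k) ⟩
  ⨁ p (λ a → ⨁ (map (zipWith _+ℕ_ a) q) (λ e → M e k))
    ≡⟨ ⨁-cong p (λ a → ⨁-map (zipWith _+ℕ_ a) q (λ e → M e k)) ⟩
  ⨁ p (λ a → ⨁ q (λ b → M (zipWith _+ℕ_ a b) k))
    ≡⟨ ⨁-cong p (λ a → ⨁-cong q (λ b → trans (monomial-+ (brackets m r) a b k) (*ₛ-coeff (M a) (M b) k))) ⟩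
  ⨁ p (λ a → ⨁ q (λ b → ⨁ I (λ i → M a i ∧ M b (k ∸ i))))
    ≡⟨ ⨁-cong p (λ a → ⨁-comm q I (λ b i → M a i ∧ M b (k ∸ i))) ⟩
  ⨁ p (λ a → ⨁ I (λ i → ⨁ q (λ b → M a i ∧ M b (k ∸ i))))
    ≡⟨ ⨁-comm p I (λ a i → ⨁ q (λ b → M a i ∧ M b (k ∸ i))) ⟩
  ⨁ I (λ i → ⨁ p (λ a → ⨁ q (λ b → M a i ∧ M b (k ∸ i))))
    ≡⟨ ⨁-cong I (λ i → sym (⨁-∧-⨁ p q (λ a → M a i) (λ b → M b (k ∸ i)))) ⟩
  ⨁ I (λ i → ⨁ p (λ a → M a i) ∧ ⨁ q (λ b → M b (k ∸ i)))
    ≡⟨ ⨁-cong I (λ i → sym (cong₂ _∧_ (φ-coeff m r p i) (φ-coeff m r q (k ∸ i)))) ⟩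
  ⨁ I (λ i → φ m r p i ∧ φ m r q (k ∸ i))
    ≡⟨ *ₛ-coeff (φ m r p) (φ m r q) k ⟨
  (φ m r p *ₛ φ m r q) k ∎
  where open ≡-Reasoning
        M = φMono m r
        I = upTo (suc k)

1ₚ : ∀ m → Poly m
1ₚ m = Vec.replicate m 0 ∷ []

φ-1 : ∀ m r → φ m r (1ₚ m) ≈ₛ 1ₛ
φ-1 m r k = trans (xor-identityʳ (φMono m r (Vec.replicate m 0) k)) (monomial-zeros (brackets m r) k)

φ-^ : ∀ m r (p : Poly m) n → φ m r (p ^ₚ n) ≈ₛ (φ m r p ^ₛ n)
φ-^ m r p zero    = φ-1 m r
φ-^ m r p (suc n) = ≈ₛ-trans (φ-* m r p (p ^ₚ n)) (*ₛ-cong {φ m r p} {φ m r p} ≈ₛ-refl (φ-^ m r p n))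

φ-*≈ : ∀ m r p q {F G} → φ m r p ≈ₛ F → φ m r q ≈ₛ G → φ m r (p *ₚ q) ≈ₛ (F *ₛ G)
φ-*≈ m r p q {F} {G} p≈ q≈ = ≈ₛ-trans (φ-* m r p q) (*ₛ-cong {φ m r p} {F} {φ m r q} {G} p≈ q≈)

φ-^≈ : ∀ m r p {F} n → φ m r p ≈ₛ F → φ m r (p ^ₚ n) ≈ₛ (F ^ₛ n)
φ-^≈ m r p n p≈ = ≈ₛ-trans (φ-^ m r p n) (^ₛ-cong n p≈)

φ-+≈ : ∀ m r p q {F G} → φ m r p ≈ₛ F → φ m r q ≈ₛ G → φ m r (p +ₚ q) ≈ₛ (F +ₛ G)
φ-+≈ m r p q {F} {G} p≈ q≈ = ≈ₛ-trans (φ-+ m r p q) (+ₛ-cong {φ m r p} {F} {φ m r q} {G} p≈ q≈)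

∏ₚ : ∀ {m n} → (Fin n → Poly m) → Poly m
∏ₚ {m} P = Vec.foldr (λ _ → Poly m) _*ₚ_ (1ₚ m) (tabulate P)

φ-∏ₚ : ∀ m r {n} (P : Fin n → Poly m) → φ m r (∏ₚ P) ≈ₛ ∏ₛ (λ t → φ m r (P t))
φ-∏ₚ m r {zero}  P = φ-1 m r
φ-∏ₚ m r {suc n} P = φ-*≈ m r (P Fin.zero) (∏ₚ (P ∘ Fin.suc)) ≈ₛ-refl (φ-∏ₚ m r (P ∘ Fin.suc))

φ-varN : ∀ m r k → 1 ≤ k → k ≤ m → φ m r (varN m k) ≈ₛ bracket m (r * + k)
φ-varN m r (suc j) (s≤s _) j<m k = trans (xor-identityʳ _)
  (monomial-single m (λ i → bracket m (r * + i)) (λ i → if i ≡ᵇ suc j then 1 else 0) j j<m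
     (cong (λ b → if b then 1 else 0) (ℕ=.≡⇒== {j} refl))
     (λ i i≢j → cong (λ b → if b then 1 else 0) (ℕ=.≢⇒==false i≢j)) k)

-- Residue classes modulo l = 2m+1

ell∸-≤ : ∀ m {s} → m < s → ell m ∸ s ≤ m
ell∸-≤ m m<s = ℕP.≤-trans (ℕP.∸-monoʳ-≤ (ell m) m<s) (ℕP.≤-reflexive (trans (ℕP.m+n∸m≡n m (m +ℕ 0)) (ℕP.+-identityʳ m)))

+ell∸ : ∀ m {s} → s ≤ ell m → + (ell m ∸ s) ≡ + ell m - + s
+ell∸ m {s} s≤l = sym (trans (ℤP.m-n≡m⊖n (ell m) s) (ℤP.⊖-≥ s≤l))

inClass : ℕ → ℤ → ℤ → Bool
inClass m A n = ((n - A) %ℕ ell m) ≡ᵇ 0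

%ℕ≡0⇒∣ : ∀ x l .{{_ : ℕ.NonZero l}} → x %ℕ l ≡ 0 → + l ∣ x
%ℕ≡0⇒∣ x l x%l≡0 = divides (x /ℕ l) (begin
  x                        ≡⟨ a≡a%ℕn+[a/ℕn]*n x l ⟩
  + (x %ℕ l) + x /ℕ l * + l ≡⟨ cong (λ t → + t + x /ℕ l * + l) x%l≡0 ⟩
  + 0 + x /ℕ l * + l        ≡⟨ ℤP.+-identityˡ _ ⟩
  x /ℕ l * + l              ∎)
  where open ≡-Reasoning

∣⇒%ℕ≡0 : ∀ x l .{{_ : ℕ.NonZero l}} → + l ∣ x → x %ℕ l ≡ 0
∣⇒%ℕ≡0 x l (divides q x≡ql) = remainder-is-multiple ∣ q - x /ℕ l ∣ (begin
  x %ℕ l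
    ≡⟨ cong ∣_∣ (remainder (+ (x %ℕ l)) (x /ℕ l) (+ l)) ⟩
  ∣ (+ (x %ℕ l) + x /ℕ l * + l) - x /ℕ l * + l ∣
    ≡⟨ cong (λ y → ∣ y - x /ℕ l * + l ∣) (trans (sym (a≡a%ℕn+[a/ℕn]*n x l)) x≡ql) ⟩
  ∣ q * + l - x /ℕ l * + l ∣
    ≡⟨ cong ∣_∣ (difference q (x /ℕ l) (+ l)) ⟩
  ∣ (q - x /ℕ l) * + l ∣
    ≡⟨ ℤP.abs-* (q - x /ℕ l) (+ l) ⟩
  ∣ q - x /ℕ l ∣ ℕ.* l ∎)
  where
  open ≡-Reasoning
  remainder : ∀ a b c → a ≡ (a + b * c) - b * c
  remainder = solve-∀
  difference : ∀ a b c → a * c - b * c ≡ (a - b) * c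
  difference = solve-∀
  remainder-is-multiple : ∀ s → x %ℕ l ≡ s ℕ.* l → x %ℕ l ≡ 0
  remainder-is-multiple zero    e = e
  remainder-is-multiple (suc s) e =
    ⊥-elim (ℕP.<⇒≱ (n%ℕd<d x l) (subst (l ≤_) (sym e) (ℕP.m≤m+n l (s ℕ.* l))))

inClass⇒∣ : ∀ {m A n} → inClass m A n ≡ true → + ell m ∣ n - A
inClass⇒∣ {m} {A} {n} e = %ℕ≡0⇒∣ (n - A) (ell m) (ℕ=.==⇒≡ e)

∣⇒inClass : ∀ {m A n} → + ell m ∣ n - A → inClass m A n ≡ true
∣⇒inClass {m} {A} {n} d = ℕ=.≡⇒== (∣⇒%ℕ≡0 (n - A) (ell m) d)

inClass-resp : ∀ m A n A' n' → (+ ell m ∣ n - A → + ell m ∣ n' - A') → (+ ell m ∣ n' - A' → + ell m ∣ n - A) →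
  inClass m A n ≡ inClass m A' n'
inClass-resp m A n A' n' f g =
  ⇔⇒≡ (∣⇒inClass {m} {A'} {n'} ∘ f ∘ inClass⇒∣ {m} {A} {n}) (∣⇒inClass {m} {A} {n} ∘ g ∘ inClass⇒∣ {m} {A'} {n'})

-- x = x·l − m·(2x)
ell∣2*⇒ell∣ : ∀ m x → + ell m ∣ + 2 * x → + ell m ∣ x
ell∣2*⇒ell∣ m x l∣2x =
  subst (+ ell m ∣_) (identity x (+ m) ell≡) (∣m∣n⇒∣m-n (∣n⇒∣m*n x ∣-refl) (∣n⇒∣m*n (+ m) l∣2x))
  where
  ell≡ : + ell m ≡ + 1 + + 2 * + m
  ell≡ = trans (ℤP.pos-+ 1 (2 ℕ.* m)) (cong (λ z → + 1 + z) (ℤP.pos-* 2 m))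
  identity : ∀ x mm {L} → L ≡ + 1 + + 2 * mm → x * L - mm * (+ 2 * x) ≡ x
  identity x mm refl = ring x mm
    where ring : ∀ x mm → x * (+ 1 + + 2 * mm) - mm * (+ 2 * x) ≡ x
          ring = solve-∀

-- Sums over a window of integers and theta-type series

infix 5 _==ℤ_
_==ℤ_ : ℤ → ℤ → Bool
x ==ℤ y = ⌊ x ℤP.≟ y ⌋

module ℤ= = Indicator _==ℤ_ (toWitness ∘ ≡true⇒T) (λ x → T⇒≡true (fromWitness {a? = x ℤP.≟ x} refl))

⨁-intsUpTo : ∀ K (h : ℤ → Bool) →
  ⨁ (intsUpTo K) h ≡ h (+ 0) xor (⨁ (upTo K) (λ a → h (+ suc a)) xor ⨁ (upTo K) (λ a → h -[1+ a ]))
⨁-intsUpTo K h = begin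
  ⨁ (map +_ (upTo (suc K)) ++ map (λ a → - (+ suc a)) (upTo K)) h
    ≡⟨ ⨁-++ (map +_ (upTo (suc K))) _ h ⟩
  ⨁ (map +_ (upTo (suc K))) h xor ⨁ (map (λ a → - (+ suc a)) (upTo K)) h
    ≡⟨ cong₂ _xor_ (trans (⨁-map +_ (upTo (suc K)) h) (⨁-upTo-suc K (h ∘ +_))) (⨁-map (λ a → - (+ suc a)) (upTo K) h) ⟩
  (h (+ 0) xor ⨁ (upTo K) (λ a → h (+ suc a))) xor ⨁ (upTo K) (λ a → h -[1+ a ])
    ≡⟨ xor-assoc (h (+ 0)) _ _ ⟩
  h (+ 0) xor (⨁ (upTo K) (λ a → h (+ suc a)) xor ⨁ (upTo K) (λ a → h -[1+ a ])) ∎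
  where open ≡-Reasoning

⨁-intsUpTo-neg : ∀ K (h : ℤ → Bool) → ⨁ (intsUpTo K) h ≡ ⨁ (intsUpTo K) (h ∘ -_)
⨁-intsUpTo-neg K h = trans (⨁-intsUpTo K h)
  (trans (cong (h (+ 0) xor_) (xor-comm (⨁ (upTo K) (λ a → h (+ suc a))) (⨁ (upTo K) (λ a → h -[1+ a ]))))
         (sym (⨁-intsUpTo K (h ∘ -_))))

⨁-intsUpTo-== : ∀ K t → ⨁ (intsUpTo K) (_==ℤ t) ≡ (∣ t ∣ ≤ᵇ K)
⨁-intsUpTo-== K t = trans (⨁-intsUpTo K (_==ℤ t)) (count t)
  where
  none : ∀ {t} (f : ℕ → ℤ) → (∀ a → f a ≢ t) → ⨁ (upTo K) (λ a → f a ==ℤ t) ≡ false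
  none f f≢t = trans (⨁-cong (upTo K) (λ a → ℤ=.≢⇒==false (f≢t a))) (⨁-false (upTo K))
  once : ∀ (f : ℕ → ℤ) n → (∀ {a} → f a ≡ f n → a ≡ n) → ⨁ (upTo K) (λ a → f a ==ℤ f n) ≡ (n <ᵇ K)
  once f n f-inj = trans (⨁-cong (upTo K) (λ a → ⇔⇒≡ (ℕ=.≡⇒== ∘ f-inj ∘ ℤ=.==⇒≡) (ℤ=.≡⇒== ∘ cong f ∘ ℕ=.==⇒≡)))
                         (⨁-upTo-≡ᵇ K n)
  count : ∀ t → ((+ 0 ==ℤ t) xor (⨁ (upTo K) (λ a → + suc a ==ℤ t) xor ⨁ (upTo K) (λ a → -[1+ a ] ==ℤ t)))
              ≡ (∣ t ∣ ≤ᵇ K)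
  count (+ zero)  = cong₂ (λ x y → true xor (x xor y)) (none {+ 0} (λ a → + suc a) (λ _ ())) (none {+ 0} -[1+_] (λ _ ()))
  count (+ suc n) = trans (cong₂ _xor_ (once (λ a → + suc a) n (ℕP.suc-injective ∘ ℤP.+-injective))
                                       (none {+ suc n} -[1+_] (λ _ ())))
                          (xor-identityʳ (n <ᵇ K))
  count -[1+ n ]  = cong₂ _xor_ (none { -[1+ n ] } (λ a → + suc a) (λ _ ())) (once -[1+_] n (λ { refl → refl }))

⨁-intsUpTo-==-∧ : ∀ K t (h : ℤ → Bool) → (h t ≡ true → ∣ t ∣ ≤ K) → ⨁ (intsUpTo K) (λ x → (x ==ℤ t) ∧ h x) ≡ h t
⨁-intsUpTo-==-∧ K t h support = begin
  ⨁ (intsUpTo K) (λ x → (x ==ℤ t) ∧ h x)  ≡⟨ ℤ=.⨁-==-∧ (intsUpTo K) t h ⟩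
  ⨁ (intsUpTo K) (_==ℤ t) ∧ h t           ≡⟨ cong (_∧ h t) (⨁-intsUpTo-== K t) ⟩
  (∣ t ∣ ≤ᵇ K) ∧ h t                      ≡⟨ ∧-absorbˡ (h t) (≤⇒≤ᵇ≡true ∘ support) ⟩
  h t                                     ∎
  where open ≡-Reasoning

⨁-intsUpTo-mono : ∀ {K K'} → K ≤ K' → (h : ℤ → Bool) → (∀ x → h x ≡ true → ∣ x ∣ ≤ K) →
  ⨁ (intsUpTo K') h ≡ ⨁ (intsUpTo K) h
⨁-intsUpTo-mono {K} {K'} K≤K' h support = begin
  ⨁ W' h
    ≡⟨ ⨁-cong W' (λ x → sym (trans (cong (_∧ h x) (⨁-intsUpTo-== K x)) (∧-absorbˡ (h x) (≤⇒≤ᵇ≡true ∘ support x)))) ⟩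
  ⨁ W' (λ x → ⨁ W (_==ℤ x) ∧ h x)
    ≡⟨ ⨁-cong W' (λ x → trans (∧-distribʳ-⨁ (h x) W (_==ℤ x)) (⨁-cong W (λ t → cong (_∧ h x) (ℤ=.==-sym t x)))) ⟩
  ⨁ W' (λ x → ⨁ W (λ t → (x ==ℤ t) ∧ h x))
    ≡⟨ ⨁-comm W' W (λ x t → (x ==ℤ t) ∧ h x) ⟩
  ⨁ W (λ t → ⨁ W' (λ x → (x ==ℤ t) ∧ h x))
    ≡⟨ ⨁-cong W (λ t → ⨁-intsUpTo-==-∧ K' t h (λ e → ℕP.≤-trans (support t e) K≤K')) ⟩
  ⨁ W h ∎
  where open ≡-Reasoning
        W = intsUpTo K
        W' = intsUpTo K'

-- Σ x^{ω n} over the n with c n; the coefficient of x^k only looks at the window −k … k,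
-- which is the whole series as long as ω dominates |n|.
Θ : (ℤ → ℕ) → (ℤ → Bool) → PS
Θ ω c k = ⨁ (intsUpTo k) (λ n → (ω n ≡ᵇ k) ∧ c n)

Θ₂ : (ℤ → ℤ → ℕ) → (ℤ → ℤ → Bool) → PS
Θ₂ ω c k = ⨁ (intsUpTo k) (λ a → ⨁ (intsUpTo k) (λ b → (ω a b ≡ᵇ k) ∧ c a b))

DominatesAbs : (ℤ → ℕ) → Set
DominatesAbs ω = ∀ n → ∣ n ∣ ≤ ω n

Θ-* : ∀ ω₁ ω₂ c₁ c₂ → DominatesAbs ω₁ → DominatesAbs ω₂ →
  (Θ ω₁ c₁ *ₛ Θ ω₂ c₂) ≈ₛ Θ₂ (λ a b → ω₁ a +ℕ ω₂ b) (λ a b → c₁ a ∧ c₂ b)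
Θ-* ω₁ ω₂ c₁ c₂ dom₁ dom₂ k = begin
  (Θ ω₁ c₁ *ₛ Θ ω₂ c₂) k
    ≡⟨ *ₛ-coeff-pairs (Θ ω₁ c₁) (Θ ω₂ c₂) ℕP.≤-refl ⟩
  ⨁ I (λ i → ⨁ I (λ j → (i +ℕ j ≡ᵇ k) ∧ (Θ ω₁ c₁ i ∧ Θ ω₂ c₂ j)))
    ≡⟨ ⨁-cong I (λ i → ⨁-cong I (λ j → ∧-congˡ-guarded (i +ℕ j ≡ᵇ k) (λ e → cong₂ _∧_
         (sym (⨁-intsUpTo-mono (i≤k i j e) (f₁ i) (λ a ea → subst (∣ a ∣ ≤_) (ℕ=.==⇒≡ (∧-elimˡ ea)) (dom₁ a))))
         (sym (⨁-intsUpTo-mono (j≤k i j e) (f₂ j) (λ b eb → subst (∣ b ∣ ≤_) (ℕ=.==⇒≡ (∧-elimˡ eb)) (dom₂ b))))))) ⟩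
  ⨁ I (λ i → ⨁ I (λ j → (i +ℕ j ≡ᵇ k) ∧ (⨁ W (f₁ i) ∧ ⨁ W (f₂ j))))
    ≡⟨ ⨁-cong I (λ i → ⨁-cong I (λ j → expand i j)) ⟩
  ⨁ I (λ i → ⨁ I (λ j → ⨁ W (λ a → ⨁ W (λ b → Q i j a b))))
    ≡⟨ ⨁-comm₂ I I W W Q ⟩
  ⨁ W (λ a → ⨁ W (λ b → ⨁ I (λ i → ⨁ I (λ j → Q i j a b))))
    ≡⟨ ⨁-cong W (λ a → ⨁-cong W (λ b → collapse a b)) ⟩
  Θ₂ (λ a b → ω₁ a +ℕ ω₂ b) (λ a b → c₁ a ∧ c₂ b) k ∎
  where
  open ≡-Reasoning
  I = upTo (suc k)
  W = intsUpTo k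
  f₁ : ℕ → ℤ → Bool
  f₁ i a = (ω₁ a ≡ᵇ i) ∧ c₁ a
  f₂ : ℕ → ℤ → Bool
  f₂ j b = (ω₂ b ≡ᵇ j) ∧ c₂ b
  i≤k : ∀ i j → (i +ℕ j ≡ᵇ k) ≡ true → i ≤ k
  i≤k i j e = subst (i ≤_) (ℕ=.==⇒≡ e) (ℕP.m≤m+n i j)
  j≤k : ∀ i j → (i +ℕ j ≡ᵇ k) ≡ true → j ≤ k
  j≤k i j e = subst (j ≤_) (ℕ=.==⇒≡ e) (ℕP.m≤n+m j i)
  Q : ℕ → ℕ → ℤ → ℤ → Bool
  Q i j a b = ((ω₁ a ≡ᵇ i) ∧ (ω₂ b ≡ᵇ j)) ∧ ((i +ℕ j ≡ᵇ k) ∧ (c₁ a ∧ c₂ b))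
  expand : ∀ i j → (i +ℕ j ≡ᵇ k) ∧ (⨁ W (f₁ i) ∧ ⨁ W (f₂ j)) ≡ ⨁ W (λ a → ⨁ W (λ b → Q i j a b))
  expand i j = begin
    (i +ℕ j ≡ᵇ k) ∧ (⨁ W (f₁ i) ∧ ⨁ W (f₂ j))
      ≡⟨ cong ((i +ℕ j ≡ᵇ k) ∧_) (⨁-∧-⨁ W W (f₁ i) (f₂ j)) ⟩
    (i +ℕ j ≡ᵇ k) ∧ ⨁ W (λ a → ⨁ W (λ b → f₁ i a ∧ f₂ j b))
      ≡⟨ ∧-distribˡ-⨁⨁ (i +ℕ j ≡ᵇ k) W W (λ a b → f₁ i a ∧ f₂ j b) ⟩
    ⨁ W (λ a → ⨁ W (λ b → (i +ℕ j ≡ᵇ k) ∧ (f₁ i a ∧ f₂ j b)))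
      ≡⟨ ⨁-cong W (λ a → ⨁-cong W (λ b → trans (cong ((i +ℕ j ≡ᵇ k) ∧_) (And.interchange (ω₁ a ≡ᵇ i) (c₁ a) (ω₂ b ≡ᵇ j) (c₂ b)))
                                                (And.x∙yz≈y∙xz (i +ℕ j ≡ᵇ k) ((ω₁ a ≡ᵇ i) ∧ (ω₂ b ≡ᵇ j)) (c₁ a ∧ c₂ b)))) ⟩
    ⨁ W (λ a → ⨁ W (λ b → Q i j a b)) ∎
  collapse : ∀ a b → ⨁ I (λ i → ⨁ I (λ j → Q i j a b)) ≡ (ω₁ a +ℕ ω₂ b ≡ᵇ k) ∧ (c₁ a ∧ c₂ b)
  collapse a b = begin
    ⨁ I (λ i → ⨁ I (λ j → ((ω₁ a ≡ᵇ i) ∧ (ω₂ b ≡ᵇ j)) ∧ P i j))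
      ≡⟨ ⨁-cong I (λ i → ⨁-cong I (λ j → trans (∧-assoc (ω₁ a ≡ᵇ i) (ω₂ b ≡ᵇ j) (P i j))
           (cong₂ (λ x y → x ∧ (y ∧ P i j)) (ℕ=.==-sym (ω₁ a) i) (ℕ=.==-sym (ω₂ b) j)))) ⟩
    ⨁ I (λ i → ⨁ I (λ j → (i ≡ᵇ ω₁ a) ∧ ((j ≡ᵇ ω₂ b) ∧ P i j)))
      ≡⟨ ⨁-cong I (λ i → sym (∧-distribˡ-⨁ (i ≡ᵇ ω₁ a) I (λ j → (j ≡ᵇ ω₂ b) ∧ P i j))) ⟩
    ⨁ I (λ i → (i ≡ᵇ ω₁ a) ∧ ⨁ I (λ j → (j ≡ᵇ ω₂ b) ∧ P i j))
      ≡⟨ ⨁-cong I (λ i → cong ((i ≡ᵇ ω₁ a) ∧_) (⨁-upTo-==-∧ (suc k) (ω₂ b) (P i)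
           (λ e → s≤s (j≤k i (ω₂ b) (∧-elimˡ e))))) ⟩
    ⨁ I (λ i → (i ≡ᵇ ω₁ a) ∧ P i (ω₂ b))
      ≡⟨ ⨁-upTo-==-∧ (suc k) (ω₁ a) (λ i → P i (ω₂ b)) (λ e → s≤s (i≤k (ω₁ a) (ω₂ b) (∧-elimˡ e))) ⟩
    P (ω₁ a) (ω₂ b) ∎
    where P : ℕ → ℕ → Bool
          P i j = (i +ℕ j ≡ᵇ k) ∧ (c₁ a ∧ c₂ b)

-- Frobenius: the cross terms cancel in pairs.
Θ-square : ∀ ω c → DominatesAbs ω → (Θ ω c *ₛ Θ ω c) ≈ₛ Θ (λ n → ω n +ℕ ω n) c
Θ-square ω c dom k = begin
  (Θ ω c *ₛ Θ ω c) k
    ≡⟨ Θ-* ω ω c c dom dom k ⟩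
  ⨁ W (λ a → ⨁ W (λ b → (ω a +ℕ ω b ≡ᵇ k) ∧ (c a ∧ c b)))
    ≡⟨ ⨁⨁-symmetric W (λ a b → (ω a +ℕ ω b ≡ᵇ k) ∧ (c a ∧ c b))
         (λ a b → cong₂ (λ s x → (s ≡ᵇ k) ∧ x) (ℕP.+-comm (ω a) (ω b)) (∧-comm (c a) (c b))) ⟩
  ⨁ W (λ a → (ω a +ℕ ω a ≡ᵇ k) ∧ (c a ∧ c a))
    ≡⟨ ⨁-cong W (λ a → cong ((ω a +ℕ ω a ≡ᵇ k) ∧_) (∧-idem (c a))) ⟩
  Θ (λ n → ω n +ℕ ω n) c k ∎
  where open ≡-Reasoning
        W = intsUpTo k

sq : ℤ → ℕ
sq n = ∣ n * n ∣

bracket-Θ : ∀ m A → bracket m A ≈ₛ Θ sq (inClass m A)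
bracket-Θ m A k = odd-length-filterᵇ (λ n → (sq n ≡ᵇ k) ∧ inClass m A n) (intsUpTo k)

Θ-cong : ∀ ω {c c'} → (∀ n → c n ≡ c' n) → Θ ω c ≈ₛ Θ ω c'
Θ-cong ω c≡c' k = ⨁-cong (intsUpTo k) (λ n → cong ((ω n ≡ᵇ k) ∧_) (c≡c' n))

bracket-resp : ∀ m {A A'} → + ell m ∣ A - A' → bracket m A ≈ₛ bracket m A'
bracket-resp m {A} {A'} l∣A-A' = begin
  bracket m A              ≈⟨ bracket-Θ m A ⟩
  Θ sq (inClass m A)       ≈⟨ Θ-cong sq (λ n → inClass-resp m A n A' n
                                (λ l∣n-A → subst (+ ell m ∣_) (shift-by n A A') (∣m∣n⇒∣m+n l∣n-A l∣A-A'))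
                                (λ l∣n-A' → subst (+ ell m ∣_) (unshift-by n A A') (∣m∣n⇒∣m-n l∣n-A' l∣A-A'))) ⟩
  Θ sq (inClass m A')      ≈⟨ bracket-Θ m A' ⟨
  bracket m A'             ∎
  where
  open ≈ₛ-Reasoning
  shift-by : ∀ n A A' → (n - A) + (A - A') ≡ n - A'
  shift-by = solve-∀
  unshift-by : ∀ n A A' → (n - A') - (A - A') ≡ n - A
  unshift-by = solve-∀

bracket-neg : ∀ m A → bracket m (- A) ≈ₛ bracket m A
bracket-neg m A k = begin
  bracket m (- A) k
    ≡⟨ bracket-Θ m (- A) k ⟩
  ⨁ (intsUpTo k) (λ n → (sq n ≡ᵇ k) ∧ inClass m (- A) n)
    ≡⟨ ⨁-intsUpTo-neg k (λ n → (sq n ≡ᵇ k) ∧ inClass m (- A) n) ⟩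
  ⨁ (intsUpTo k) (λ n → (sq (- n) ≡ᵇ k) ∧ inClass m (- A) (- n))
    ≡⟨ ⨁-cong (intsUpTo k) (λ n → cong₂ _∧_ (cong (λ z → ∣ z ∣ ≡ᵇ k) (neg-square n))
         (inClass-resp m (- A) (- n) A n (λ l∣ → subst (+ ell m ∣_) (neg-neg-diff n A) (∣m⇒∣-m l∣))
                           (λ l∣ → subst (+ ell m ∣_) (sym (neg-diff n A)) (∣m⇒∣-m l∣)))) ⟩
  ⨁ (intsUpTo k) (λ n → (sq n ≡ᵇ k) ∧ inClass m A n)
    ≡⟨ bracket-Θ m A k ⟨
  bracket m A k ∎
  where
  open ≡-Reasoning
  neg-square : ∀ n → (- n) * (- n) ≡ n * n
  neg-square = solve-∀
  neg-neg-diff : ∀ n A → - ((- n) - (- A)) ≡ n - A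
  neg-neg-diff = solve-∀
  neg-diff : ∀ n A → (- n) - (- A) ≡ - (n - A)
  neg-diff = solve-∀

sq₂ : ℤ → ℕ
sq₂ n = sq n +ℕ sq n

sq₄ : ℤ → ℕ
sq₄ n = sq₂ n +ℕ sq₂ n

+sq≡* : ∀ n → + sq n ≡ n * n
+sq≡* (+ a)    = trans (cong (λ z → + ∣ z ∣) (sym (ℤP.pos-* a a))) (ℤP.pos-* a a)
+sq≡* -[1+ a ] = refl

sq-dominatesAbs : DominatesAbs sq
sq-dominatesAbs n = subst (∣ n ∣ ≤_) (sym (ℤP.abs-* n n)) (n≤n*n ∣ n ∣)
  where n≤n*n : ∀ n → n ≤ n ℕ.* n
        n≤n*n zero    = z≤n
        n≤n*n (suc n) = ℕP.m≤m*n (suc n) (suc n)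

sq₂-dominatesAbs : DominatesAbs sq₂
sq₂-dominatesAbs n = ℕP.≤-trans (sq-dominatesAbs n) (ℕP.m≤m+n (sq n) (sq n))

sq₄-dominatesAbs : DominatesAbs sq₄
sq₄-dominatesAbs n = ℕP.≤-trans (sq₂-dominatesAbs n) (ℕP.m≤m+n (sq₂ n) (sq₂ n))

+sq₂≡ : ∀ n → + sq₂ n ≡ n * n + n * n
+sq₂≡ n = trans (ℤP.pos-+ (sq n) (sq n)) (cong₂ _+_ (+sq≡* n) (+sq≡* n))

sq-double : ∀ x → sq (+ 2 * x) ≡ sq₄ x
sq-double x = ℤP.+-injective (begin
  + sq (+ 2 * x)                    ≡⟨ +sq≡* (+ 2 * x) ⟩
  (+ 2 * x) * (+ 2 * x)             ≡⟨ ring x ⟩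
  (x * x + x * x) + (x * x + x * x) ≡⟨ cong₂ _+_ (+sq₂≡ x) (+sq₂≡ x) ⟨
  + sq₂ x + + sq₂ x                 ≡⟨ ℤP.pos-+ (sq₂ x) (sq₂ x) ⟨
  + sq₄ x                           ∎)
  where open ≡-Reasoning
        ring : ∀ x → (+ 2 * x) * (+ 2 * x) ≡ (x * x + x * x) + (x * x + x * x)
        ring = solve-∀

sq-parallelogram : ∀ c d → sq (c + d) +ℕ sq (c - d) ≡ sq₂ c +ℕ sq₂ d
sq-parallelogram c d = ℤP.+-injective (begin
  + (sq (c + d) +ℕ sq (c - d))            ≡⟨ ℤP.pos-+ (sq (c + d)) (sq (c - d)) ⟩
  + sq (c + d) + + sq (c - d)             ≡⟨ cong₂ _+_ (+sq≡* (c + d)) (+sq≡* (c - d)) ⟩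
  (c + d) * (c + d) + (c - d) * (c - d)   ≡⟨ ring c d ⟩
  (c * c + c * c) + (d * d + d * d)       ≡⟨ cong₂ _+_ (+sq₂≡ c) (+sq₂≡ d) ⟨
  + sq₂ c + + sq₂ d                       ≡⟨ ℤP.pos-+ (sq₂ c) (sq₂ d) ⟨
  + (sq₂ c +ℕ sq₂ d)                      ∎)
  where open ≡-Reasoning
        ring : ∀ c d → (c + d) * (c + d) + (c - d) * (c - d) ≡ (c * c + c * c) + (d * d + d * d)
        ring = solve-∀

inClass-double : ∀ m A x → inClass m (+ 2 * A) (+ 2 * x) ≡ inClass m A x
inClass-double m A x = inClass-resp m (+ 2 * A) (+ 2 * x) A x
  (λ l∣ → ell∣2*⇒ell∣ m (x - A) (subst (+ ell m ∣_) (factor x A) l∣))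
  (λ l∣ → subst (+ ell m ∣_) (sym (factor x A)) (∣n⇒∣m*n (+ 2) l∣))
  where factor : ∀ x A → (+ 2 * x) - (+ 2 * A) ≡ + 2 * (x - A)
        factor = solve-∀

inClass-sum-diff : ∀ m A B c d →
  (inClass m (+ 2 * A) (c + d) ∧ inClass m (+ 2 * B) (c - d)) ≡ (inClass m (A + B) c ∧ inClass m (A - B) d)
inClass-sum-diff m A B c d = ⇔⇒≡
  (λ e → let l∣₁ = inClass⇒∣ {m} {+ 2 * A} {c + d} (∧-elimˡ e)
             l∣₂ = inClass⇒∣ {m} {+ 2 * B} {c - d} (∧-elimʳ e) in
     ∧-intro (∣⇒inClass {m} {A + B} {c} (ell∣2*⇒ell∣ m (c - (A + B)) (subst (+ ell m ∣_) (e₁ A B c d) (∣m∣n⇒∣m+n l∣₁ l∣₂))))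
             (∣⇒inClass {m} {A - B} {d} (ell∣2*⇒ell∣ m (d - (A - B)) (subst (+ ell m ∣_) (e₂ A B c d) (∣m∣n⇒∣m-n l∣₁ l∣₂)))))
  (λ e → let l∣₁ = inClass⇒∣ {m} {A + B} {c} (∧-elimˡ e)
             l∣₂ = inClass⇒∣ {m} {A - B} {d} (∧-elimʳ e) in
     ∧-intro (∣⇒inClass {m} {+ 2 * A} {c + d} (subst (+ ell m ∣_) (e₃ A B c d) (∣m∣n⇒∣m+n l∣₁ l∣₂)))
             (∣⇒inClass {m} {+ 2 * B} {c - d} (subst (+ ell m ∣_) (e₄ A B c d) (∣m∣n⇒∣m-n l∣₁ l∣₂))))
  where
  e₁ : ∀ A B c d → ((c + d) - (+ 2 * A)) + ((c - d) - (+ 2 * B)) ≡ + 2 * (c - (A + B))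
  e₁ = solve-∀
  e₂ : ∀ A B c d → ((c + d) - (+ 2 * A)) - ((c - d) - (+ 2 * B)) ≡ + 2 * (d - (A - B))
  e₂ = solve-∀
  e₃ : ∀ A B c d → (c - (A + B)) + (d - (A - B)) ≡ (c + d) - (+ 2 * A)
  e₃ = solve-∀
  e₄ : ∀ A B c d → (c - (A + B)) - (d - (A - B)) ≡ (c - d) - (+ 2 * B)
  e₄ = solve-∀

even-or-odd : ∀ a → Σ ℤ (λ p → (a ≡ + 2 * p) ⊎ (a ≡ + 2 * p + + 1))
even-or-odd a = by-remainder (a %ℕ 2) (n%ℕd<d a 2) (a≡a%ℕn+[a/ℕn]*n a 2)
  where
  q = a /ℕ 2
  by-remainder : ∀ r → r < 2 → a ≡ + r + q * + 2 → Σ ℤ (λ p → (a ≡ + 2 * p) ⊎ (a ≡ + 2 * p + + 1))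
  by-remainder 0 _ e = q , inj₁ (trans e (ring q))
    where ring : ∀ q → + 0 + q * + 2 ≡ + 2 * q
          ring = solve-∀
  by-remainder 1 _ e = q , inj₂ (trans e (ring q))
    where ring : ∀ q → + 1 + q * + 2 ≡ + 2 * q + + 1
          ring = solve-∀
  by-remainder (suc (suc r)) (s≤s (s≤s ())) e

even≢odd : ∀ x y → + 2 * x ≢ + 2 * y + + 1
even≢odd x y 2x≡2y+1 = 1≢2* ∣ x - y ∣ (trans (cong ∣_∣ 1≡2[x-y]) (ℤP.abs-* (+ 2) (x - y)))
  where
  1≡2[x-y] : + 1 ≡ + 2 * (x - y)
  1≡2[x-y] = trans (ring₁ y) (trans (cong (_- + 2 * y) (sym 2x≡2y+1)) (ring₂ x y))
    where ring₁ : ∀ y → + 1 ≡ ((+ 2 * y) + + 1) - (+ 2 * y)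
          ring₁ = solve-∀
          ring₂ : ∀ x y → (+ 2 * x) - (+ 2 * y) ≡ + 2 * (x - y)
          ring₂ = solve-∀
  1≢2* : ∀ s → 1 ≢ 2 ℕ.* s
  1≢2* zero    ()
  1≢2* (suc s) e = ℕP.m+1+n≢0 s (sym (ℕP.suc-injective e))

isEvenᵇ : ℕ → ℤ → Bool
isEvenᵇ K a = ⨁ (intsUpTo K) (λ x → a ==ℤ + 2 * x)

sumDiffᵇ : ℕ → ℤ → ℤ → Bool
sumDiffᵇ K a b = ⨁ (intsUpTo K) (λ c → ⨁ (intsUpTo K) (λ d → (a ==ℤ c + d) ∧ (b ==ℤ c - d)))

isEvenᵇ-even : ∀ K p → ∣ p ∣ ≤ K → isEvenᵇ K (+ 2 * p) ≡ true
isEvenᵇ-even K p ∣p∣≤K = begin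
  ⨁ (intsUpTo K) (λ x → + 2 * p ==ℤ + 2 * x)
    ≡⟨ ⨁-cong (intsUpTo K) (λ x → ℤ=.==-resp (sym ∘ ℤP.*-cancelˡ-≡ (+ 2) p x) (cong (+ 2 *_) ∘ sym)) ⟩
  ⨁ (intsUpTo K) (_==ℤ p)
    ≡⟨ ⨁-intsUpTo-== K p ⟩
  ∣ p ∣ ≤ᵇ K
    ≡⟨ ≤⇒≤ᵇ≡true ∣p∣≤K ⟩
  true ∎
  where open ≡-Reasoning

isEvenᵇ-odd : ∀ K p → isEvenᵇ K (+ 2 * p + + 1) ≡ false
isEvenᵇ-odd K p =
  trans (⨁-cong (intsUpTo K) (λ x → ℤ=.≢⇒==false (even≢odd x p ∘ sym))) (⨁-false (intsUpTo K))

sumDiffᵇ-row : ∀ K a b c → ⨁ (intsUpTo K) (λ d → (a ==ℤ c + d) ∧ (b ==ℤ c - d)) ≡ (∣ a - c ∣ ≤ᵇ K) ∧ (b ==ℤ c - (a - c))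
sumDiffᵇ-row K a b c = begin
  ⨁ W (λ d → (a ==ℤ c + d) ∧ (b ==ℤ c - d))
    ≡⟨ ⨁-cong W (λ d → cong (_∧ (b ==ℤ c - d))
         (ℤ=.==-resp (λ e → trans (ring₁ c d) (cong (_- c) (sym e)))
                     (λ e → trans (sym (ring₂ c a)) (cong (λ z → c + z) (sym e))))) ⟩
  ⨁ W (λ d → (d ==ℤ a - c) ∧ (b ==ℤ c - d))
    ≡⟨ ℤ=.⨁-==-∧ W (a - c) (λ d → b ==ℤ c - d) ⟩
  ⨁ W (_==ℤ a - c) ∧ (b ==ℤ c - (a - c))
    ≡⟨ cong (_∧ (b ==ℤ c - (a - c))) (⨁-intsUpTo-== K (a - c)) ⟩
  (∣ a - c ∣ ≤ᵇ K) ∧ (b ==ℤ c - (a - c)) ∎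
  where
  open ≡-Reasoning
  W = intsUpTo K
  ring₁ : ∀ c d → d ≡ (c + d) - c
  ring₁ = solve-∀
  ring₂ : ∀ c a → c + (a - c) ≡ a
  ring₂ = solve-∀

sumDiffᵇ-sum-diff : ∀ K s t → ∣ s ∣ ≤ K → ∣ t ∣ ≤ K → sumDiffᵇ K (s + t) (s - t) ≡ true
sumDiffᵇ-sum-diff K s t ∣s∣≤K ∣t∣≤K = begin
  sumDiffᵇ K (s + t) (s - t)
    ≡⟨ ⨁-cong W (sumDiffᵇ-row K (s + t) (s - t)) ⟩
  ⨁ W (λ c → (∣ (s + t) - c ∣ ≤ᵇ K) ∧ (s - t ==ℤ c - ((s + t) - c)))
    ≡⟨ ⨁-cong W (λ c → trans (∧-comm (∣ (s + t) - c ∣ ≤ᵇ K) _) (cong (_∧ (∣ (s + t) - c ∣ ≤ᵇ K)) (ℤ=.==-resp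
         (λ e → ℤP.*-cancelˡ-≡ (+ 2) c s (trans (ring₁ s t c) (trans (cong (_+ (s + t)) (sym e)) (ring₂ s t))))
         (λ e → trans (ring₃ s t) (cong (λ z → z - ((s + t) - z)) (sym e)))))) ⟩
  ⨁ W (λ c → (c ==ℤ s) ∧ (∣ (s + t) - c ∣ ≤ᵇ K))
    ≡⟨ ⨁-intsUpTo-==-∧ K s (λ c → ∣ (s + t) - c ∣ ≤ᵇ K) (λ _ → ∣s∣≤K) ⟩
  ∣ (s + t) - s ∣ ≤ᵇ K
    ≡⟨ trans (cong (λ z → ∣ z ∣ ≤ᵇ K) (ring₄ s t)) (≤⇒≤ᵇ≡true ∣t∣≤K) ⟩
  true ∎
  where
  open ≡-Reasoning
  W = intsUpTo K
  ring₁ : ∀ s t c → + 2 * c ≡ (c - ((s + t) - c)) + (s + t)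
  ring₁ = solve-∀
  ring₂ : ∀ s t → (s - t) + (s + t) ≡ + 2 * s
  ring₂ = solve-∀
  ring₃ : ∀ s t → s - t ≡ s - ((s + t) - s)
  ring₃ = solve-∀
  ring₄ : ∀ s t → (s + t) - s ≡ t
  ring₄ = solve-∀

sumDiffᵇ-odd-sum : ∀ K a b p → a + b ≡ + 2 * p + + 1 → sumDiffᵇ K a b ≡ false
sumDiffᵇ-odd-sum K a b p a+b≡odd = trans (⨁-cong W (λ c → trans (sumDiffᵇ-row K a b c)
    (trans (cong ((∣ a - c ∣ ≤ᵇ K) ∧_)
                 (ℤ=.≢⇒==false (λ e → even≢odd c p (trans (ring a c) (trans (cong (λ z → a + z) (sym e)) a+b≡odd)))))
           (∧-zeroʳ (∣ a - c ∣ ≤ᵇ K)))))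
  (⨁-false W)
  where W = intsUpTo K
        ring : ∀ a c → + 2 * c ≡ a + (c - (a - c))
        ring = solve-∀

sq+sq-bounds : ∀ a b k → sq a +ℕ sq b ≡ k → (∣ a ∣ ≤ k) × (∣ b ∣ ≤ k)
sq+sq-bounds a b k e = ℕP.≤-trans (sq-dominatesAbs a) (subst (sq a ≤_) e (ℕP.m≤m+n (sq a) (sq b)))
                     , ℕP.≤-trans (sq-dominatesAbs b) (subst (sq b ≤_) e (ℕP.m≤n+m (sq b) (sq a)))

∣p∣≤∣2p∣ : ∀ p → ∣ p ∣ ≤ ∣ + 2 * p ∣
∣p∣≤∣2p∣ p = subst (∣ p ∣ ≤_) (sym (ℤP.abs-* (+ 2) p)) (ℕP.m≤m+n ∣ p ∣ (∣ p ∣ +ℕ 0))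

sumDiffᵇ-on-circle : ∀ k s t → sq (s + t) +ℕ sq (s - t) ≡ k → sumDiffᵇ k (s + t) (s - t) ≡ true
sumDiffᵇ-on-circle k s t on-circle = sumDiffᵇ-sum-diff k s t
  (ℕP.≤-trans (sq₂-dominatesAbs s) (subst (sq₂ s ≤_) on-circle′ (ℕP.m≤m+n (sq₂ s) (sq₂ t))))
  (ℕP.≤-trans (sq₂-dominatesAbs t) (subst (sq₂ t ≤_) on-circle′ (ℕP.m≤n+m (sq₂ t) (sq₂ s))))
  where on-circle′ = trans (sym (sq-parallelogram s t)) on-circle

sumDiffᵇ-on-circle′ : ∀ k {a b} s t → a ≡ s + t → b ≡ s - t → sq a +ℕ sq b ≡ k → sumDiffᵇ k a b ≡ true
sumDiffᵇ-on-circle′ k s t refl refl = sumDiffᵇ-on-circle k s t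

parity-count-even-even : ∀ k p q → sq (+ 2 * p) +ℕ sq (+ 2 * q) ≡ k →
  (isEvenᵇ k (+ 2 * p) xor isEvenᵇ k (+ 2 * q)) xor sumDiffᵇ k (+ 2 * p) (+ 2 * q) ≡ true
parity-count-even-even k p q on-circle = cong₂ _xor_
  (cong₂ _xor_ (isEvenᵇ-even k p (ℕP.≤-trans (∣p∣≤∣2p∣ p) (proj₁ (sq+sq-bounds (+ 2 * p) (+ 2 * q) k on-circle))))
               (isEvenᵇ-even k q (ℕP.≤-trans (∣p∣≤∣2p∣ q) (proj₂ (sq+sq-bounds (+ 2 * p) (+ 2 * q) k on-circle)))))
  (sumDiffᵇ-on-circle′ k (p + q) (p - q) (ring₁ p q) (ring₂ p q) on-circle)
  where ring₁ : ∀ p q → + 2 * p ≡ (p + q) + (p - q)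
        ring₁ = solve-∀
        ring₂ : ∀ p q → + 2 * q ≡ (p + q) - (p - q)
        ring₂ = solve-∀

parity-count-odd-odd : ∀ k p q → sq (+ 2 * p + + 1) +ℕ sq (+ 2 * q + + 1) ≡ k →
  (isEvenᵇ k (+ 2 * p + + 1) xor isEvenᵇ k (+ 2 * q + + 1)) xor sumDiffᵇ k (+ 2 * p + + 1) (+ 2 * q + + 1) ≡ true
parity-count-odd-odd k p q on-circle = cong₂ _xor_ (cong₂ _xor_ (isEvenᵇ-odd k p) (isEvenᵇ-odd k q))
  (sumDiffᵇ-on-circle′ k (p + q + + 1) (p - q) (ring₁ p q) (ring₂ p q) on-circle)
  where ring₁ : ∀ p q → + 2 * p + + 1 ≡ (p + q + + 1) + (p - q)
        ring₁ = solve-∀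
        ring₂ : ∀ p q → + 2 * q + + 1 ≡ (p + q + + 1) - (p - q)
        ring₂ = solve-∀

parity-count-even-odd : ∀ k p q → sq (+ 2 * p) +ℕ sq (+ 2 * q + + 1) ≡ k →
  (isEvenᵇ k (+ 2 * p) xor isEvenᵇ k (+ 2 * q + + 1)) xor sumDiffᵇ k (+ 2 * p) (+ 2 * q + + 1) ≡ true
parity-count-even-odd k p q on-circle = cong₂ _xor_
  (cong₂ _xor_ (isEvenᵇ-even k p (ℕP.≤-trans (∣p∣≤∣2p∣ p) (proj₁ (sq+sq-bounds (+ 2 * p) (+ 2 * q + + 1) k on-circle))))
               (isEvenᵇ-odd k q))
  (sumDiffᵇ-odd-sum k (+ 2 * p) (+ 2 * q + + 1) (p + q) (ring p q))
  where ring : ∀ p q → + 2 * p + (+ 2 * q + + 1) ≡ + 2 * (p + q) + + 1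
        ring = solve-∀

parity-count-odd-even : ∀ k p q → sq (+ 2 * p + + 1) +ℕ sq (+ 2 * q) ≡ k →
  (isEvenᵇ k (+ 2 * p + + 1) xor isEvenᵇ k (+ 2 * q)) xor sumDiffᵇ k (+ 2 * p + + 1) (+ 2 * q) ≡ true
parity-count-odd-even k p q on-circle = cong₂ _xor_
  (cong₂ _xor_ (isEvenᵇ-odd k p)
               (isEvenᵇ-even k q (ℕP.≤-trans (∣p∣≤∣2p∣ q) (proj₂ (sq+sq-bounds (+ 2 * p + + 1) (+ 2 * q) k on-circle)))))
  (sumDiffᵇ-odd-sum k (+ 2 * p + + 1) (+ 2 * q) (p + q) (ring p q))
  where ring : ∀ p q → (+ 2 * p + + 1) + + 2 * q ≡ + 2 * (p + q) + + 1
        ring = solve-∀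

-- Whatever the parities of a and b, the three counts add up to 1 mod 2.
parity-count : ∀ k a b → sq a +ℕ sq b ≡ k → (isEvenᵇ k a xor isEvenᵇ k b) xor sumDiffᵇ k a b ≡ true
parity-count k a b on-circle with even-or-odd a | even-or-odd b
... | p , inj₁ refl | q , inj₁ refl = parity-count-even-even k p q on-circle
... | p , inj₂ refl | q , inj₂ refl = parity-count-odd-odd k p q on-circle
... | p , inj₁ refl | q , inj₂ refl = parity-count-even-odd k p q on-circle
... | p , inj₂ refl | q , inj₁ refl = parity-count-odd-even k p q on-circle

-- The theta identity [A]⁴[2B] + [B]⁴[2A] + [2A][2B] + [A+B]²[A−B]² = 0

module _ (m k : ℕ) where

  onCircle : ℤ → ℤ → ℤ → ℤ → Bool
  onCircle A B a b = (sq a +ℕ sq b ≡ᵇ k) ∧ (inClass m (+ 2 * A) a ∧ inClass m (+ 2 * B) b)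

  onCircle-bounds : ∀ A B a b → onCircle A B a b ≡ true → (∣ a ∣ ≤ k) × (∣ b ∣ ≤ k)
  onCircle-bounds A B a b e = sq+sq-bounds a b k (ℕ=.==⇒≡ (∧-elimˡ e))

  onCircle-swap : ∀ A B a b → onCircle A B a b ≡ onCircle B A b a
  onCircle-swap A B a b =
    cong₂ (λ s x → (s ≡ᵇ k) ∧ x) (ℕP.+-comm (sq a) (sq b)) (∧-comm (inClass m (+ 2 * A) a) (inClass m (+ 2 * B) b))

  ⨁-onCircle-isEvenˡ : ∀ A B →
    ⨁ (intsUpTo k) (λ a → ⨁ (intsUpTo k) (λ b → onCircle A B a b ∧ isEvenᵇ k a))
    ≡ Θ₂ (λ x y → sq₄ x +ℕ sq y) (λ x y → inClass m A x ∧ inClass m (+ 2 * B) y) k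
  ⨁-onCircle-isEvenˡ A B = begin
    ⨁ W (λ a → ⨁ W (λ b → onCircle A B a b ∧ isEvenᵇ k a))
      ≡⟨ ⨁-cong W (λ a → ⨁-cong W (λ b → trans (∧-distribˡ-⨁ (onCircle A B a b) W (λ x → a ==ℤ + 2 * x))
           (⨁-cong W (λ x → ∧-comm (onCircle A B a b) (a ==ℤ + 2 * x))))) ⟩
    ⨁ W (λ a → ⨁ W (λ b → ⨁ W (λ x → (a ==ℤ + 2 * x) ∧ onCircle A B a b)))
      ≡⟨ ⨁-cong W (λ a → ⨁-comm W W (λ b x → (a ==ℤ + 2 * x) ∧ onCircle A B a b)) ⟩
    ⨁ W (λ a → ⨁ W (λ x → ⨁ W (λ b → (a ==ℤ + 2 * x) ∧ onCircle A B a b)))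
      ≡⟨ ⨁-comm W W (λ a x → ⨁ W (λ b → (a ==ℤ + 2 * x) ∧ onCircle A B a b)) ⟩
    ⨁ W (λ x → ⨁ W (λ a → ⨁ W (λ b → (a ==ℤ + 2 * x) ∧ onCircle A B a b)))
      ≡⟨ ⨁-cong W (λ x → ⨁-comm W W (λ a b → (a ==ℤ + 2 * x) ∧ onCircle A B a b)) ⟩
    ⨁ W (λ x → ⨁ W (λ b → ⨁ W (λ a → (a ==ℤ + 2 * x) ∧ onCircle A B a b)))
      ≡⟨ ⨁-cong W (λ x → ⨁-cong W (λ b → ⨁-intsUpTo-==-∧ k (+ 2 * x) (λ a → onCircle A B a b)
           (proj₁ ∘ onCircle-bounds A B (+ 2 * x) b))) ⟩
    ⨁ W (λ x → ⨁ W (λ b → onCircle A B (+ 2 * x) b))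
      ≡⟨ ⨁-cong W (λ x → ⨁-cong W (λ b → cong₂ (λ s c → (s +ℕ sq b ≡ᵇ k) ∧ (c ∧ inClass m (+ 2 * B) b))
           (sq-double x) (inClass-double m A x))) ⟩
    Θ₂ (λ x y → sq₄ x +ℕ sq y) (λ x y → inClass m A x ∧ inClass m (+ 2 * B) y) k ∎
    where open ≡-Reasoning
          W = intsUpTo k

  ⨁-onCircle-isEvenʳ : ∀ A B →
    ⨁ (intsUpTo k) (λ a → ⨁ (intsUpTo k) (λ b → onCircle A B a b ∧ isEvenᵇ k b))
    ≡ Θ₂ (λ x y → sq₄ x +ℕ sq y) (λ x y → inClass m B x ∧ inClass m (+ 2 * A) y) k
  ⨁-onCircle-isEvenʳ A B = begin
    ⨁ W (λ a → ⨁ W (λ b → onCircle A B a b ∧ isEvenᵇ k b))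
      ≡⟨ ⨁-comm W W (λ a b → onCircle A B a b ∧ isEvenᵇ k b) ⟩
    ⨁ W (λ b → ⨁ W (λ a → onCircle A B a b ∧ isEvenᵇ k b))
      ≡⟨ ⨁-cong W (λ b → ⨁-cong W (λ a → cong (_∧ isEvenᵇ k b) (onCircle-swap A B a b))) ⟩
    ⨁ W (λ b → ⨁ W (λ a → onCircle B A b a ∧ isEvenᵇ k b))
      ≡⟨ ⨁-onCircle-isEvenˡ B A ⟩
    Θ₂ (λ x y → sq₄ x +ℕ sq y) (λ x y → inClass m B x ∧ inClass m (+ 2 * A) y) k ∎
    where open ≡-Reasoning
          W = intsUpTo k

  ⨁-onCircle-sumDiff : ∀ A B →
    ⨁ (intsUpTo k) (λ a → ⨁ (intsUpTo k) (λ b → onCircle A B a b ∧ sumDiffᵇ k a b))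
    ≡ Θ₂ (λ c d → sq₂ c +ℕ sq₂ d) (λ c d → inClass m (A + B) c ∧ inClass m (A - B) d) k
  ⨁-onCircle-sumDiff A B = begin
    ⨁ W (λ a → ⨁ W (λ b → onCircle A B a b ∧ sumDiffᵇ k a b))
      ≡⟨ ⨁-cong W (λ a → ⨁-cong W (λ b → expand a b)) ⟩
    ⨁ W (λ a → ⨁ W (λ b → ⨁ W (λ c → ⨁ W (λ d → Q a b c d))))
      ≡⟨ ⨁-comm₂ W W W W Q ⟩
    ⨁ W (λ c → ⨁ W (λ d → ⨁ W (λ a → ⨁ W (λ b → Q a b c d))))
      ≡⟨ ⨁-cong W (λ c → ⨁-cong W (λ d → collapse c d)) ⟩
    Θ₂ (λ c d → sq₂ c +ℕ sq₂ d) (λ c d → inClass m (A + B) c ∧ inClass m (A - B) d) k ∎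
    where
    open ≡-Reasoning
    W = intsUpTo k
    Q : ℤ → ℤ → ℤ → ℤ → Bool
    Q a b c d = (a ==ℤ c + d) ∧ ((b ==ℤ c - d) ∧ onCircle A B a b)
    expand : ∀ a b → onCircle A B a b ∧ sumDiffᵇ k a b ≡ ⨁ W (λ c → ⨁ W (λ d → Q a b c d))
    expand a b = trans (∧-distribˡ-⨁⨁ (onCircle A B a b) W W (λ c d → (a ==ℤ c + d) ∧ (b ==ℤ c - d)))
      (⨁-cong W (λ c → ⨁-cong W (λ d → trans (∧-comm (onCircle A B a b) _) (∧-assoc (a ==ℤ c + d) _ _))))
    collapse : ∀ c d → ⨁ W (λ a → ⨁ W (λ b → Q a b c d)) ≡ (sq₂ c +ℕ sq₂ d ≡ᵇ k) ∧ (inClass m (A + B) c ∧ inClass m (A - B) d)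
    collapse c d = begin
      ⨁ W (λ a → ⨁ W (λ b → Q a b c d))
        ≡⟨ ⨁-cong W (λ a → trans (sym (∧-distribˡ-⨁ (a ==ℤ c + d) W (λ b → (b ==ℤ c - d) ∧ onCircle A B a b)))
             (cong ((a ==ℤ c + d) ∧_) (⨁-intsUpTo-==-∧ k (c - d) (onCircle A B a) (proj₂ ∘ onCircle-bounds A B a (c - d))))) ⟩
      ⨁ W (λ a → (a ==ℤ c + d) ∧ onCircle A B a (c - d))
        ≡⟨ ⨁-intsUpTo-==-∧ k (c + d) (λ a → onCircle A B a (c - d)) (proj₁ ∘ onCircle-bounds A B (c + d) (c - d)) ⟩
      onCircle A B (c + d) (c - d)
        ≡⟨ cong₂ _∧_ (cong (_≡ᵇ k) (sq-parallelogram c d)) (inClass-sum-diff m A B c d) ⟩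
      (sq₂ c +ℕ sq₂ d ≡ᵇ k) ∧ (inClass m (A + B) c ∧ inClass m (A - B) d) ∎

  ⨁-onCircle-split : ∀ A B →
    Θ₂ (λ a b → sq a +ℕ sq b) (λ a b → inClass m (+ 2 * A) a ∧ inClass m (+ 2 * B) b) k
    ≡ (Θ₂ (λ x y → sq₄ x +ℕ sq y) (λ x y → inClass m A x ∧ inClass m (+ 2 * B) y) k
       xor Θ₂ (λ x y → sq₄ x +ℕ sq y) (λ x y → inClass m B x ∧ inClass m (+ 2 * A) y) k)
      xor Θ₂ (λ c d → sq₂ c +ℕ sq₂ d) (λ c d → inClass m (A + B) c ∧ inClass m (A - B) d) k
  ⨁-onCircle-split A B = begin
    ⨁ W (λ a → ⨁ W (λ b → H a b))
      ≡⟨ ⨁-cong W (λ a → ⨁-cong W (λ b → split-by-parity a b)) ⟩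
    ⨁ W (λ a → ⨁ W (λ b → ((H a b ∧ isEvenᵇ k a) xor (H a b ∧ isEvenᵇ k b)) xor (H a b ∧ sumDiffᵇ k a b)))
      ≡⟨ ⨁⨁-distrib-xor W W (λ a b → (H a b ∧ isEvenᵇ k a) xor (H a b ∧ isEvenᵇ k b)) (λ a b → H a b ∧ sumDiffᵇ k a b) ⟩
    ⨁ W (λ a → ⨁ W (λ b → (H a b ∧ isEvenᵇ k a) xor (H a b ∧ isEvenᵇ k b))) xor ⨁ W (λ a → ⨁ W (λ b → H a b ∧ sumDiffᵇ k a b))
      ≡⟨ cong (_xor ⨁ W (λ a → ⨁ W (λ b → H a b ∧ sumDiffᵇ k a b)))
           (⨁⨁-distrib-xor W W (λ a b → H a b ∧ isEvenᵇ k a) (λ a b → H a b ∧ isEvenᵇ k b)) ⟩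
    (⨁ W (λ a → ⨁ W (λ b → H a b ∧ isEvenᵇ k a)) xor ⨁ W (λ a → ⨁ W (λ b → H a b ∧ isEvenᵇ k b)))
      xor ⨁ W (λ a → ⨁ W (λ b → H a b ∧ sumDiffᵇ k a b))
      ≡⟨ cong₂ _xor_ (cong₂ _xor_ (⨁-onCircle-isEvenˡ A B) (⨁-onCircle-isEvenʳ A B)) (⨁-onCircle-sumDiff A B) ⟩
    (Θ₂ (λ x y → sq₄ x +ℕ sq y) (λ x y → inClass m A x ∧ inClass m (+ 2 * B) y) k
       xor Θ₂ (λ x y → sq₄ x +ℕ sq y) (λ x y → inClass m B x ∧ inClass m (+ 2 * A) y) k)
      xor Θ₂ (λ c d → sq₂ c +ℕ sq₂ d) (λ c d → inClass m (A + B) c ∧ inClass m (A - B) d) k ∎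
    where
    open ≡-Reasoning
    W = intsUpTo k
    H = onCircle A B
    split-by-parity : ∀ a b → H a b ≡ ((H a b ∧ isEvenᵇ k a) xor (H a b ∧ isEvenᵇ k b)) xor (H a b ∧ sumDiffᵇ k a b)
    split-by-parity a b = begin
      H a b
        ≡⟨ ∧-absorbˡ (H a b) (λ e → parity-count k a b (ℕ=.==⇒≡ (∧-elimˡ e))) ⟨
      ((isEvenᵇ k a xor isEvenᵇ k b) xor sumDiffᵇ k a b) ∧ H a b
        ≡⟨ ∧-comm _ (H a b) ⟩
      H a b ∧ ((isEvenᵇ k a xor isEvenᵇ k b) xor sumDiffᵇ k a b)
        ≡⟨ ∧-distribˡ-xor (H a b) _ _ ⟩
      (H a b ∧ (isEvenᵇ k a xor isEvenᵇ k b)) xor (H a b ∧ sumDiffᵇ k a b)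
        ≡⟨ cong (_xor (H a b ∧ sumDiffᵇ k a b)) (∧-distribˡ-xor (H a b) _ _) ⟩
      ((H a b ∧ isEvenᵇ k a) xor (H a b ∧ isEvenᵇ k b)) xor (H a b ∧ sumDiffᵇ k a b) ∎

bracket-^2 : ∀ m A → (bracket m A ^ₛ 2) ≈ₛ Θ sq₂ (inClass m A)
bracket-^2 m A = begin
  θ *ₛ (θ *ₛ 1ₛ)                        ≈⟨ *ₛ-cong {θ} {θ} ≈ₛ-refl (*ₛ-identityʳ θ) ⟩
  θ *ₛ θ                                ≈⟨ *ₛ-cong {θ} {Θ sq c} (bracket-Θ m A) (bracket-Θ m A) ⟩
  Θ sq c *ₛ Θ sq c                      ≈⟨ Θ-square sq c sq-dominatesAbs ⟩
  Θ sq₂ c                               ∎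
  where open ≈ₛ-Reasoning
        θ = bracket m A
        c = inClass m A

bracket-^4 : ∀ m A → (bracket m A ^ₛ 4) ≈ₛ Θ sq₄ (inClass m A)
bracket-^4 m A = begin
  θ ^ₛ (2 +ℕ 2)                         ≈⟨ ^ₛ-distribˡ-+-*ₛ θ 2 2 ⟩
  (θ ^ₛ 2) *ₛ (θ ^ₛ 2)                  ≈⟨ *ₛ-cong {θ ^ₛ 2} {Θ sq₂ c} (bracket-^2 m A) (bracket-^2 m A) ⟩
  Θ sq₂ c *ₛ Θ sq₂ c                    ≈⟨ Θ-square sq₂ c sq₂-dominatesAbs ⟩
  Θ sq₄ c                               ∎
  where open ≈ₛ-Reasoning
        θ = bracket m A
        c = inClass m A

theta-identity : ∀ m A B →
  ((((bracket m A ^ₛ 4) *ₛ bracket m (+ 2 * B)) +ₛ ((bracket m B ^ₛ 4) *ₛ bracket m (+ 2 * A)))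
   +ₛ ((bracket m (+ 2 * A) *ₛ bracket m (+ 2 * B)) +ₛ ((bracket m (A + B) ^ₛ 2) *ₛ (bracket m (A - B) ^ₛ 2))))
  ≈ₛ 0ₛ
theta-identity m A B k = begin
  (((θ A ^ₛ 4) *ₛ θ (+ 2 * B)) k xor ((θ B ^ₛ 4) *ₛ θ (+ 2 * A)) k)
    xor ((θ (+ 2 * A) *ₛ θ (+ 2 * B)) k xor ((θ (A + B) ^ₛ 2) *ₛ (θ (A - B) ^ₛ 2)) k)
    ≡⟨ cong₂ _xor_ (cong₂ _xor_ (coefficient (bracket-^4 m A) (bracket-Θ m (+ 2 * B)) sq₄-dominatesAbs sq-dominatesAbs)
                                (coefficient (bracket-^4 m B) (bracket-Θ m (+ 2 * A)) sq₄-dominatesAbs sq-dominatesAbs))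
                   (cong₂ _xor_ (coefficient (bracket-Θ m (+ 2 * A)) (bracket-Θ m (+ 2 * B)) sq-dominatesAbs sq-dominatesAbs)
                                (coefficient (bracket-^2 m (A + B)) (bracket-^2 m (A - B)) sq₂-dominatesAbs sq₂-dominatesAbs)) ⟩
  (t₁ xor t₂) xor (Θ₂ (λ a b → sq a +ℕ sq b) (λ a b → inClass m (+ 2 * A) a ∧ inClass m (+ 2 * B) b) k xor t₄)
    ≡⟨ cong (λ t → (t₁ xor t₂) xor (t xor t₄)) (⨁-onCircle-split m k A B) ⟩
  (t₁ xor t₂) xor (((t₁ xor t₂) xor t₄) xor t₄)
    ≡⟨ cancel (t₁ xor t₂) t₄ ⟩
  false ∎
  where
  open ≡-Reasoning
  θ = bracket m
  t₁ = Θ₂ (λ x y → sq₄ x +ℕ sq y) (λ x y → inClass m A x ∧ inClass m (+ 2 * B) y) k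
  t₂ = Θ₂ (λ x y → sq₄ x +ℕ sq y) (λ x y → inClass m B x ∧ inClass m (+ 2 * A) y) k
  t₄ = Θ₂ (λ c d → sq₂ c +ℕ sq₂ d) (λ c d → inClass m (A + B) c ∧ inClass m (A - B) d) k
  coefficient : ∀ {f g ω₁ ω₂ c₁ c₂} → f ≈ₛ Θ ω₁ c₁ → g ≈ₛ Θ ω₂ c₂ → DominatesAbs ω₁ → DominatesAbs ω₂ →
    (f *ₛ g) k ≡ Θ₂ (λ a b → ω₁ a +ℕ ω₂ b) (λ a b → c₁ a ∧ c₂ b) k
  coefficient {f} {g} {ω₁} {ω₂} {c₁} {c₂} f≈ g≈ dom₁ dom₂ =
    trans (*ₛ-cong {f} {Θ ω₁ c₁} {g} {Θ ω₂ c₂} f≈ g≈ k) (Θ-* ω₁ ω₂ c₁ c₂ dom₁ dom₂ k)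
  cancel : ∀ x y → x xor ((x xor y) xor y) ≡ false
  cancel x y = begin
    x xor ((x xor y) xor y) ≡⟨ cong (x xor_) (xor-assoc x y y) ⟩
    x xor (x xor (y xor y)) ≡⟨ cong (λ z → x xor (x xor z)) (xor-same y) ⟩
    x xor (x xor false)     ≡⟨ cong (x xor_) (xor-identityʳ x) ⟩
    x xor x                 ≡⟨ xor-same x ⟩
    false                   ∎

-- φ_r takes values in S

-- Every class x ≢ 0 mod l is ±J for some 1 ≤ J ≤ m, and [−J] = [J].
bracket-representative : ∀ m x → ¬ (+ ell m ∣ x) →
  Σ ℕ λ J → (1 ≤ J) × (J ≤ m) × (bracket m (+ J) ≈ₛ bracket m x)
bracket-representative m x l∤x = by-remainder (x %ℕ ell m) (n%ℕd<d x (ell m)) (a≡a%ℕn+[a/ℕn]*n x (ell m))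
  where
  q = x /ℕ ell m
  by-remainder : ∀ t → t < ell m → x ≡ + t + q * + ell m →
    Σ ℕ λ J → (1 ≤ J) × (J ≤ m) × (bracket m (+ J) ≈ₛ bracket m x)
  by-remainder zero    _     x≡ = ⊥-elim (l∤x (divides q (trans x≡ (ℤP.+-identityˡ _))))
  by-remainder (suc t) t<l x≡ with suc t ℕP.≤? m
  ... | yes t≤m = suc t , s≤s z≤n , t≤m ,
      bracket-resp m (subst (+ ell m ∣_) (ring (+ suc t) q (+ ell m) x x≡) (∣m⇒∣-m (∣n⇒∣m*n q ∣-refl)))
    where ring : ∀ t q L x → x ≡ t + q * L → - (q * L) ≡ t - x
          ring t q L x refl = solve t q L
            where solve : ∀ t q L → - (q * L) ≡ t - (t + q * L)
                  solve = solve-∀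
  ... | no  t≰m = ell m ∸ suc t , ℕP.m<n⇒0<n∸m t<l , ell∸-≤ m (ℕP.≰⇒> t≰m) ,
      ≈ₛ-trans (≈ₛ-sym (bracket-neg m (+ (ell m ∸ suc t))))
               (bracket-resp m (subst (+ ell m ∣_) (ring (+ ell m) (+ suc t) q x (+ (ell m ∸ suc t)) x≡ (+ell∸ m (ℕP.<⇒≤ t<l)))
                                      (∣m∣n⇒∣m-n (∣m⇒∣-m ∣-refl) (∣n⇒∣m*n q ∣-refl))))
    where ring : ∀ L t q x J → x ≡ t + q * L → J ≡ L - t → - L - q * L ≡ - J - x
          ring L t q x J refl refl = solve L t q
            where solve : ∀ L t q → - L - q * L ≡ - (L - t) - (t + q * L)
                  solve = solve-∀

ell∤r*k : ∀ m r → Coprime ∣ r ∣ (ell m) → ∀ k → 1 ≤ k → k ≤ m → ¬ (+ ell m ∣ r * + k)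
ell∤r*k m r r⊥l (suc k) _ k≤m l∣rk = ℕP.<⇒≱ (s≤s (ℕP.≤-trans k≤m (ℕP.m≤m+n m (m +ℕ 0))))
  (∣⇒≤ (coprime-divisor (Coprime-sym r⊥l) (subst (ell m ℕ∣_) (ℤP.abs-* r (+ suc k)) (∣⇒∣ᵤ l∣rk))))

-- Replace x_k by x_{J k}, where [J k] = [r k]: φ_1 of the result is φ_r.
module _ (m : ℕ) (r : ℤ) (r⊥l : Coprime ∣ r ∣ (ell m)) where

  representative : (t : Fin m) → Σ ℕ λ J → (1 ≤ J) × (J ≤ m) × (bracket m (+ J) ≈ₛ bracket m (r * + suc (toℕ t)))
  representative t = bracket-representative m (r * + suc (toℕ t)) (ell∤r*k m r r⊥l (suc (toℕ t)) (s≤s z≤n) (FinP.toℕ<n t))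

  substitute : Mono m → Poly m
  substitute e = ∏ₚ (λ t → varN m (proj₁ (representative t)) ^ₚ lookup e t)

  φ₁-substitute : ∀ e → φ m (+ 1) (substitute e) ≈ₛ φMono m r e
  φ₁-substitute e = ≈ₛ-trans (φ-∏ₚ m (+ 1) {m} (λ t → varN m (proj₁ (representative t)) ^ₚ lookup e t)) (∏ₛ-cong λ t →
    let (J , 1≤J , J≤m , [J]≈) = representative t in
    φ-^≈ m (+ 1) (varN m J) (lookup e t)
      (≈ₛ-trans (φ-varN m (+ 1) J 1≤J J≤m) (≈ₛ-trans (≡⇒≈ₛ (cong (bracket m) (ℤP.*-identityˡ (+ J)))) [J]≈)))

  φ-∈S : ∀ p → InS m (φ m r p)
  φ-∈S p = concatMap substitute p , λ k → begin
    φ m (+ 1) (concatMap substitute p) k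
      ≡⟨ φ-coeff m (+ 1) (concatMap substitute p) k ⟩
    ⨁ (concatMap substitute p) (λ e → φMono m (+ 1) e k)
      ≡⟨ ⨁-concatMap substitute p (λ e → φMono m (+ 1) e k) ⟩
    ⨁ p (λ e → ⨁ (substitute e) (λ e′ → φMono m (+ 1) e′ k))
      ≡⟨ ⨁-cong p (λ e → trans (sym (φ-coeff m (+ 1) (substitute e) k)) (φ₁-substitute e k)) ⟩
    ⨁ p (λ e → φMono m r e k)
      ≡⟨ φ-coeff m r p k ⟨
    φ m r p k ∎
    where open ≡-Reasoning

-- φ_r kills the ideal N

-- x_s for m < s ≤ 2m is x_{l−s}, and [r(l−s)] = [−rs] = [rs].
φ-X : ∀ m r s → 1 ≤ s → s ≤ 2 ℕ.* m → φ m r (X m s) ≈ₛ bracket m (r * + s)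
φ-X m r s 1≤s s≤2m with s ≤ᵇ m in s≤ᵇm
... | true  = φ-varN m r s 1≤s (ℕP.≤ᵇ⇒≤ s m (≡true⇒T s≤ᵇm))
... | false = begin
  φ m r (varN m (ell m ∸ s))       ≈⟨ φ-varN m r (ell m ∸ s) (ℕP.m<n⇒0<n∸m (s≤s s≤2m)) (ell∸-≤ m m<s) ⟩
  bracket m (r * + (ell m ∸ s))    ≈⟨ bracket-resp m (subst (+ ell m ∣_) (ring r (+ ell m) (+ s) (+ell∸ m (ℕP.<⇒≤ (s≤s s≤2m))))
                                                        (∣n⇒∣m*n r ∣-refl)) ⟩
  bracket m (- (r * + s))          ≈⟨ bracket-neg m (r * + s) ⟩
  bracket m (r * + s)              ∎
  where
  open ≈ₛ-Reasoning
  m<s : m < s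
  m<s = ℕP.≰⇒> (λ s≤m → case trans (sym s≤ᵇm) (T⇒≡true (ℕP.≤⇒≤ᵇ s≤m)) of λ ())
  ring : ∀ r L S {T} → T ≡ L - S → r * L ≡ r * T - (- (r * S))
  ring r L S refl = solve r L S
    where solve : ∀ r L S → r * L ≡ r * (L - S) - (- (r * S))
          solve = solve-∀

φ-X≈ : ∀ m r s {t} → 1 ≤ s → s ≤ 2 ℕ.* m → r * + s ≡ t → φ m r (X m s) ≈ₛ bracket m t
φ-X≈ m r s 1≤s s≤2m refl = φ-X m r s 1≤s s≤2m

φ-R : ∀ m r i j → 1 ≤ j → j < i → i ≤ m → φ m r (R m i j) ≈ₛ 0ₛ
φ-R m r i j 1≤j j<i i≤m = ≈ₛ-trans
  (φ-+≈ m r (P₁ +ₚ P₂) (P₃ +ₚ P₄)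
    (φ-+≈ m r P₁ P₂ (φ-*≈ m r (xᵢ ^ₚ 4) x₂ⱼ (φ-^≈ m r xᵢ 4 φxᵢ) φx₂ⱼ) (φ-*≈ m r (xⱼ ^ₚ 4) x₂ᵢ (φ-^≈ m r xⱼ 4 φxⱼ) φx₂ᵢ))
    (φ-+≈ m r P₃ P₄ (φ-*≈ m r x₂ᵢ x₂ⱼ φx₂ᵢ φx₂ⱼ)
                    (φ-*≈ m r (xᵢ₊ⱼ ^ₚ 2) (xᵢ₋ⱼ ^ₚ 2) (φ-^≈ m r xᵢ₊ⱼ 2 φxᵢ₊ⱼ) (φ-^≈ m r xᵢ₋ⱼ 2 φxᵢ₋ⱼ))))
  (theta-identity m (r * + i) (r * + j))
  where
  j≤m = ℕP.≤-trans (ℕP.<⇒≤ j<i) i≤m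
  1≤i = ℕP.≤-trans 1≤j (ℕP.<⇒≤ j<i)
  ≤2m : ∀ {s} → s ≤ m → s ≤ 2 ℕ.* m
  ≤2m s≤m = ℕP.≤-trans s≤m (ℕP.m≤m+n _ _)
  double-≤2m : ∀ {s} → s ≤ m → 2 ℕ.* s ≤ 2 ℕ.* m
  double-≤2m = ℕP.*-monoʳ-≤ 2
  1≤double : ∀ {s} → 1 ≤ s → 1 ≤ 2 ℕ.* s
  1≤double 1≤s = ℕP.≤-trans 1≤s (ℕP.m≤m+n _ _)
  distrib-minus : ∀ r a b → r * (a - b) ≡ r * a - r * b
  distrib-minus = solve-∀
  r*2s : ∀ s → r * + (2 ℕ.* s) ≡ + 2 * (r * + s)
  r*2s s = trans (cong (r *_) (ℤP.pos-* 2 s)) (ring r (+ s))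
    where ring : ∀ r s → r * (+ 2 * s) ≡ + 2 * (r * s)
          ring = solve-∀
  xᵢ = X m i
  xⱼ = X m j
  x₂ᵢ = X m (2 ℕ.* i)
  x₂ⱼ = X m (2 ℕ.* j)
  xᵢ₊ⱼ = X m (i +ℕ j)
  xᵢ₋ⱼ = X m (i ∸ j)
  P₁ = (xᵢ ^ₚ 4) *ₚ x₂ⱼ
  P₂ = (xⱼ ^ₚ 4) *ₚ x₂ᵢ
  P₃ = x₂ᵢ *ₚ x₂ⱼ
  P₄ = (xᵢ₊ⱼ ^ₚ 2) *ₚ (xᵢ₋ⱼ ^ₚ 2)
  φxᵢ = φ-X m r i 1≤i (≤2m i≤m)
  φxⱼ = φ-X m r j 1≤j (≤2m j≤m)
  φx₂ᵢ = φ-X≈ m r (2 ℕ.* i) (1≤double 1≤i) (double-≤2m i≤m) (r*2s i)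
  φx₂ⱼ = φ-X≈ m r (2 ℕ.* j) (1≤double 1≤j) (double-≤2m j≤m) (r*2s j)
  φxᵢ₊ⱼ = φ-X≈ m r (i +ℕ j) (ℕP.≤-trans 1≤i (ℕP.m≤m+n i j))
           (ℕP.≤-trans (ℕP.+-mono-≤ i≤m j≤m) (ℕP.≤-reflexive (cong (m +ℕ_) (sym (ℕP.+-identityʳ m)))))
           (trans (cong (r *_) (ℤP.pos-+ i j)) (ℤP.*-distribˡ-+ r (+ i) (+ j)))
  φxᵢ₋ⱼ = φ-X≈ m r (i ∸ j) (ℕP.m<n⇒0<n∸m j<i) (ℕP.≤-trans (ℕP.m∸n≤m i j) (≤2m i≤m))
           (trans (cong (r *_) (sym (trans (ℤP.m-n≡m⊖n i j) (ℤP.⊖-≥ (ℕP.<⇒≤ j<i))))) (distrib-minus r (+ i) (+ j)))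

φ-Rgens : ∀ m r → All (λ g → φ m r g ≈ₛ 0ₛ) (Rgens m)
φ-Rgens m r = AllP.concat⁺ (AllP.map⁺ (AllP.applyUpTo⁺₁ (λ i → i) m (λ {i} i<m →
  AllP.applyUpTo⁺₁ (λ j → R m (suc i) (suc j)) i (λ {j} j<i → φ-R m r (suc i) (suc j) (s≤s z≤n) (s≤s j<i) i<m))))

φ-sumLin-kernel : ∀ m r (cs gs : List (Poly m)) → All (λ g → φ m r g ≈ₛ 0ₛ) gs → φ m r (sumLin cs gs) ≈ₛ 0ₛ
φ-sumLin-kernel m r []       gs       _              = ≈ₛ-refl
φ-sumLin-kernel m r (c ∷ cs) []       _              = ≈ₛ-refl
φ-sumLin-kernel m r (c ∷ cs) (g ∷ gs) (φg≈0 ∷ φgs≈0) =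
  ≈ₛ-trans (φ-+≈ m r (c *ₚ g) (sumLin cs gs) (φ-*≈ m r c g ≈ₛ-refl φg≈0) (φ-sumLin-kernel m r cs gs φgs≈0))
           (≈ₛ-trans (+ₛ-cong {φ m r c *ₛ 0ₛ} {0ₛ} {0ₛ} {0ₛ} (*ₛ-zeroʳ (φ m r c)) ≈ₛ-refl) (+ₛ-identityʳ 0ₛ))

∈⟨∷⟩ : ∀ {m} (u : Poly m) gs → u ∈⟨ u ∷ gs ⟩
∈⟨∷⟩ {m} u gs = 1ₚ m ∷ List.replicate (length gs) [] , cong suc (ListP.length-replicate (length gs)) ,
  λ e → cong (λ p → coeff p e) (sym (trans (cong₂ _++_ (trans (ListP.++-identityʳ _) (map-zeros u)) (sumLin-zeros gs))
                                           (ListP.++-identityʳ u)))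
  where
  zipWith-zeros : ∀ {n} (b : Vec ℕ n) → zipWith _+ℕ_ (Vec.replicate n 0) b ≡ b
  zipWith-zeros []      = refl
  zipWith-zeros (x ∷ b) = cong (x ∷_) (zipWith-zeros b)
  map-zeros : ∀ (u : Poly m) → map (zipWith _+ℕ_ (Vec.replicate m 0)) u ≡ u
  map-zeros []      = refl
  map-zeros (x ∷ u) = cong₂ _∷_ (zipWith-zeros x) (map-zeros u)
  sumLin-zeros : ∀ (gs : List (Poly m)) → sumLin (List.replicate (length gs) []) gs ≡ []
  sumLin-zeros []       = refl
  sumLin-zeros (g ∷ gs) = sumLin-zeros gs

theorem3p9 : (m : ℕ) → 0 < m → (r : ℤ) → Coprime ∣ r ∣ (ell m) →
    (u v : Poly m) →
    (λ p → p ∈⟨ v ∷ Rgens m ⟩) ≐ (λ p → p ∈⟨ u ∷ v ∷ Rgens m ⟩) →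
    ¬ (φ m r v ≈ₛ 0ₛ) →
    Σ PS λ s → InS m s × ((s *ₛ φ m r v) ≈ₛ φ m r u)
theorem3p9 m _ r r⊥l u v ideals-equal _ with proj₂ (ideals-equal u) (∈⟨∷⟩ u (v ∷ Rgens m))
... | c ∷ cs , _ , u≈cv+n = φ m r c , φ-∈S m r r⊥l c , ≈ₛ-sym (begin
  φ m r u                                    ≈⟨ φ-cong m r u ((c *ₚ v) +ₚ sumLin cs (Rgens m)) u≈cv+n ⟩
  φ m r ((c *ₚ v) +ₚ sumLin cs (Rgens m))    ≈⟨ φ-+≈ m r (c *ₚ v) (sumLin cs (Rgens m)) (φ-* m r c v)
                                                  (φ-sumLin-kernel m r cs (Rgens m) (φ-Rgens m r)) ⟩
  (φ m r c *ₛ φ m r v) +ₛ 0ₛ                 ≈⟨ +ₛ-identityʳ (φ m r c *ₛ φ m r v) ⟩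
  φ m r c *ₛ φ m r v                         ∎)
  where open ≈ₛ-Reasoning
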